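{- Let $P,Q\in\mathbb Z$ with $Q\ne0$, $f(t)=t^2-Pt+Q$ with roots $\theta_1,\theta_2$, $D=P^2-4Q\neq0$, and let $p$ be a prime with $p\nmid Q$; write $D=p^sD_0$ with $s\ge0$, $p\nmid D_0$. For $R\in\{\mathbb Q,\mathbb Z_{(p)},\mathbb F_p\}$ let $G^*_R(f)$ be as in the context. (1) If $f$ is irreducible over $\mathbb Q$, then $G^*_{\mathbb Q}(f)\xrightarrow{\sim}\mathbb Q(\theta_1)^{\times}/\mathbb Q^{\times}\langle\theta_1\rangle$, $[w_1:w_0]\mapsto w_1-w_0\theta_1$. If $f$ is reducible over $\mathbb Q$, then $G^*_{\mathbb Q}(f)\xrightarrow{\sim}\mathbb Q^{\times}/\langle\theta_1\theta_2^{ -1}\rangle$, $[w_1:w_0]\mapsto(w_1-w_0\theta_1)(w_1-w_0\theta_2)^{ -1}$. (2) If $f$ is irreducible over $\mathbb Q$, then $G^*_{\mathbb Z_{(p)}}(f)\xrightarrow{\sim}\mathbb Z_{(p)}[\theta_1]^{\times}/\mathbb Z_{(p)}^{\times}\langle\theta_1\rangle$, $[w_1:w_0]\mapsto w_1-w_0\theta_1$. If $f$ is reducible over $\mathbb Q$, then $G^*_{\mathbb Z_{(p)}}(f)$ is isomorphic to $\mathbb Z_{(p)}^{\times}/\langle\theta_1\theta_2^{ -1}\rangle$ if $p\nmid D$ and to $(1+p^{s/2}\mathbb Z_{(p)})/\langle\theta_1\theta_2^{ -1}\rangle$ if $p\mid D$, via $[w_1:w_0]\mapsto(w_1-w_0\theta_1)(w_1-w_0\theta_2)^{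 -1}$. (3)(i) If $f\bmod p$ is irreducible over $\mathbb F_p$, then $G^*_{\mathbb F_p}(f)\xrightarrow{\sim}\mathbb F_p(\theta_1)^{\times}/\mathbb F_p^{\times}\langle\theta_1\rangle$, $[w_1:w_0]\mapsto w_1-w_0\theta_1$. (ii) If $f\bmod p$ is reducible over $\mathbb F_p$: if $p\nmid D$, then $G^*_{\mathbb F_p}(f)\xrightarrow{\sim}\mathbb F_p^{\times}/\langle\theta_1\theta_2^{ -1}\rangle$, $[w_1:w_0]\mapsto(w_1-w_0\theta_1)(w_1-w_0\theta_2)^{ -1}$; if $p\mid D$, then $G^*_{\mathbb F_p}(f)$ is trivial.
   Context: For an integral domain $R$ in which $Q$ is a unit, let $\mathscr S(f,R)^{\times}$ be the set of sequences $(w_n)_{n\in\mathbb Z}$ in $R$ with $w_{n+2}-Pw_{n+1}+Qw_n=0$ and $w_1^2-Pw_0w_1+Qw_0^2\in R^{\times}$; it is an abelian group with product $(w_n)*(v_n)=(u_n)$, $u_1=w_1v_1-Qw_0v_0$, $u_0=w_0v_1+w_1v_0-Pw_0v_0$. Define ${\bf w}\sim^*{\bf v}$ if there are $\lambda\in R^{\times}$ and $\nu\in\mathbb Z$ with $w_n=\lambda v_{n+\nu}$ for all $n$; $G^*_R(f):=\mathscr S(f,R)^{\times}/\sim^*$ with the induced group structure, and $[w_1:w_0]$ is the class of the sequence with initial terms $w_1,w_0$. For $R=\mathbb F_p$, everything is reduced mod $p$. ($G^*_{\mathbb Q}(f)$ is naturally identified with Laxton's group $G^*(f)$.) -}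

module Defs where

open import Level using (0ℓ)
open import Data.Nat as ℕ using (ℕ; zero; suc)
open import Data.Nat.Primality using (Prime)
open import Data.Nat.Divisibility using (_∣_)
open import Data.Integer as ℤ using (ℤ; +_)
open import Data.Integer.Divisibility as ℤD using ()
open import Data.Rational as ℚ using (ℚ; ↧ₙ_)
open import Data.Product using (Σ; _×_; _,_; proj₁; proj₂)
open import Data.Sum using (_⊎_)
open import Data.Unit using (⊤)
open import Relation.Nullary using (¬_)
open import Relation.Binary.PropositionalEquality using (_≡_)
open import Function.Bundles using (_⇔_)

-- A bare "ring signature": carrier with a setoid-style equality,
-- ring operations and the canonical map from ℤ.  (No laws are needed to
-- *state* the theorem; the concrete instances below are genuine rings.)

record Rng : Set₁ where
  infixl 6 _+_ _-_
  infixl 7 _*_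
  infix 4 _≈_
  field
    Carrier : Set
    _≈_     : Carrier → Carrier → Set
    _+_     : Carrier → Carrier → Carrier
    _*_     : Carrier → Carrier → Carrier
    -_      : Carrier → Carrier
    0#      : Carrier
    1#      : Carrier
    ι       : ℤ → Carrier

  _-_ : Carrier → Carrier → Carrier
  x - y = x + (- y)

  _^_ : Carrier → ℕ → Carrier
  x ^ zero  = 1#
  x ^ suc k = x * (x ^ k)

ℚR : Rng
ℚR = record
  { Carrier = ℚ ; _≈_ = _≡_ ; _+_ = ℚ._+_ ; _*_ = ℚ._*_ ; -_ = ℚ.-_
  ; 0# = ℚ.0ℚ ; 1# = ℚ.1ℚ ; ι = λ n → n ℚ./ 1 }

InZp : ℕ → ℚ → Set
InZp p q = ¬ (p ∣ (↧ₙ q))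

-- 𝔽_p presented as ℤ with equality "congruent modulo p"
_≡[mod_]_ : ℤ → ℕ → ℤ → Set
x ≡[mod p ] y = (+ p) ℤD.∣ (x ℤ.- y)

FpR : ℕ → Rng
FpR p = record
  { Carrier = ℤ ; _≈_ = λ x y → x ≡[mod p ] y ; _+_ = ℤ._+_ ; _*_ = ℤ._*_
  ; -_ = ℤ.-_ ; 0# = + 0 ; 1# = + 1 ; ι = λ n → n }

-- The quadratic extension K[t]/(t² - P t + Q); the pair (a , b) stands for
-- a + b·θ where θ is the class of t (so θ² = Pθ - Q).
Ext : Rng → ℤ → ℤ → Rng
Ext K P Q = record
  { Carrier = Carrier × Carrier
  ; _≈_ = λ x y → (proj₁ x ≈ proj₁ y) × (proj₂ x ≈ proj₂ y)
  ; _+_ = λ x y → (proj₁ x + proj₁ y , proj₂ x + proj₂ y)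
  ; _*_ = λ x y → ( proj₁ x * proj₁ y - ι Q * (proj₂ x * proj₂ y)
                  , proj₁ x * proj₂ y + proj₂ x * proj₁ y + ι P * (proj₂ x * proj₂ y))
  ; -_ = λ x → (- proj₁ x , - proj₂ x)
  ; 0# = (0# , 0#) ; 1# = (1# , 0#) ; ι = λ n → (ι n , 0#) }
  where open Rng K

module _ (K : Rng) where
  open Rng K

  Unit : (Carrier → Set) → Carrier → Set
  Unit S x = S x × Σ Carrier (λ y → S y × (x * y ≈ 1#))

  InCyc : Carrier → Carrier → Set
  InCyc g y = Σ ℕ (λ k → (y ≈ g ^ k) ⊎ (y * g ^ k ≈ 1#))

  QRel : (Carrier → Set) → Carrier → Carrier → Set
  QRel H x y = Σ Carrier (λ h → H h × (x ≈ h * y))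

module _ (K : Rng) (S : Rng.Carrier K → Set) (P Q : ℤ) where
  open Rng K

  -- elements of 𝒮(f,R)^× for R = S : sequences indexed by ℤ
  IsSeq : (ℤ → Carrier) → Set
  IsSeq w = (∀ n → S (w n))
          × (∀ n → w (n ℤ.+ + 2) ≈ ι P * w (n ℤ.+ + 1) - ι Q * w n)
          × Unit K S (w (+ 1) * w (+ 1) - ι P * w (+ 0) * w (+ 1)
                        + ι Q * w (+ 0) * w (+ 0))

  Sim : (ℤ → Carrier) → (ℤ → Carrier) → Set
  Sim w v = Σ Carrier (λ c → Unit K S c × Σ ℤ (λ ν → ∀ n → w n ≈ c * v (n ℤ.+ ν)))

  IsProd : (ℤ → Carrier) → (ℤ → Carrier) → (ℤ → Carrier) → Set
  IsProd w v u = (u (+ 1) ≈ w (+ 1) * v (+ 1) - ι Q * w (+ 0) * v (+ 0))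
               × (u (+ 0) ≈ w (+ 0) * v (+ 1) + w (+ 1) * v (+ 0) - ι P * w (+ 0) * v (+ 0))

  -- "G*_R(f) → T/H, [w₁:w₀] ↦ x  (Φ w x)  is a well-defined group isomorphism"
  -- A : ambient ring of the target, T : target group (as a subset of A),
  -- H : the subgroup (subset of T), Φ w x : "x is the image of w".
  IsIso : (A : Rng) → (Rng.Carrier A → Set) → (Rng.Carrier A → Set)
        → ((ℤ → Carrier) → Rng.Carrier A → Set) → Set
  IsIso A T H Φ =
      (∀ w → IsSeq w → Σ (Rng.Carrier A) (λ x → Φ w x × T x))
    × (∀ w v x y → IsSeq w → IsSeq v → Φ w x → Φ v y
         → Sim w v ⇔ QRel A H x y)
    × (∀ w v u x y z → IsSeq w → IsSeq v → IsSeq u → IsProd w v u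
         → Φ w x → Φ v y → Φ u z → QRel A H z (Rng._*_ A x y))
    × (∀ t → T t → Σ (ℤ → Carrier) (λ w → Σ (Rng.Carrier A) (λ x →
         IsSeq w × Φ w x × QRel A H x t)))

  Trivial : Set
  Trivial = ∀ w v → IsSeq w → IsSeq v → Sim w v

  -- irreducible case: G*_R(f) ≅ S[θ]^× / S^×⟨θ⟩ via [w₁:w₀] ↦ w₁ - w₀θ
  IrrIso : Set
  IrrIso = IsIso E
    (Unit E (λ x → S (proj₁ x) × S (proj₂ x)))
    (λ y → Σ Carrier (λ c → Σ (Rng.Carrier E) (λ z →
              Unit K S c × InCyc E θ z × Rng._≈_ E y (Rng._*_ E (c , 0#) z))))
    (λ w x → Rng._≈_ E x (w (+ 1) , - w (+ 0)))
    where
      E = Ext K P Q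
      θ : Rng.Carrier E
      θ = (0# , 1#)

  -- reducible case, roots θ₁ θ₂ ∈ K and r = θ₁θ₂⁻¹ :
  -- G*_R(f) ≅ T / ⟨r⟩ via [w₁:w₀] ↦ (w₁ - w₀θ₁)(w₁ - w₀θ₂)⁻¹
  RedIso : Carrier → Carrier → Carrier → (Carrier → Set) → Set
  RedIso θ₁ θ₂ r T = IsIso K T (InCyc K r)
    (λ w x → x * (w (+ 1) - w (+ 0) * θ₂) ≈ w (+ 1) - w (+ 0) * θ₁)

  Roots : Carrier → Carrier → Set
  Roots θ₁ θ₂ = (θ₁ + θ₂ ≈ ι P) × (θ₁ * θ₂ ≈ ι Q)

  -- f is reducible over K: f = (t - a)(t - b) with a, b ∈ K
  -- (a monic quadratic over a field factors iff it splits into monic linear factors)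
  Reducible : Set
  Reducible = Σ Carrier (λ a → Σ Carrier (λ b → Roots a b))

Disc : ℤ → ℤ → ℤ
Disc P Q = P ℤ.* P ℤ.- + 4 ℤ.* Q

all : ℚ → Set
all _ = ⊤

allℤ : ℤ → Set
allℤ _ = ⊤

Part1 : ℤ → ℤ → Set
Part1 P Q =
    (¬ Reducible ℚR all P Q → IrrIso ℚR all P Q)
  × (∀ θ₁ θ₂ r → Roots ℚR all P Q θ₁ θ₂ → r ℚ.* θ₂ ≡ θ₁
       → RedIso ℚR all P Q θ₁ θ₂ r (Unit ℚR all))

-- p prime, D = p^s · D₀
Part2 : ℤ → ℤ → ℕ → ℕ → Set
Part2 P Q p s =
    (¬ Reducible ℚR all P Q → IrrIso ℚR (InZp p) P Q)
  × (∀ θ₁ θ₂ r → Roots ℚR all P Q θ₁ θ₂ → r ℚ.* θ₂ ≡ θ₁ →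
         (¬ ((+ p) ℤD.∣ Disc P Q) → RedIso ℚR (InZp p) P Q θ₁ θ₂ r (Unit ℚR (InZp p)))
       × ((+ p) ℤD.∣ Disc P Q → RedIso ℚR (InZp p) P Q θ₁ θ₂ r
            (λ x → Σ ℚ (λ z → InZp p z × (x ≡ ℚ.1ℚ ℚ.+ ((+ (p ℕ.^ (s ℕ./ 2))) ℚ./ 1) ℚ.* z)))))

Part3 : ℤ → ℤ → ℕ → Set
Part3 P Q p =
    (¬ Reducible (FpR p) allℤ P Q → IrrIso (FpR p) allℤ P Q)
  × (∀ θ₁ θ₂ r → Roots (FpR p) allℤ P Q θ₁ θ₂ → (r ℤ.* θ₂) ≡[mod p ] θ₁ →
         (¬ ((+ p) ℤD.∣ Disc P Q) → RedIso (FpR p) allℤ P Q θ₁ θ₂ r (Unit (FpR p) allℤ)))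
  × ((+ p) ℤD.∣ Disc P Q → Reducible (FpR p) allℤ P Q → Trivial (FpR p) allℤ P Q)

{-# OPTIONS --safe #-}

-- Let θ₁, θ₂ be the roots of f.  For a solution w, the form w(n+1) - θ₁ w(n) is a geometric sequence of
-- ratio θ₂, and the norm w₁² - P w₀ w₁ + Q w₀² is the product of the two forms w₁ - θ₁ w₀ and w₁ - θ₂ w₀.
-- Hence [w₁ : w₀] ↦ w₁ - w₀θ₁ (divided by w₁ - w₀θ₂ when f splits) sends units to units, turns the shift
-- by ν into multiplication by θ₂^ν (by (θ₁/θ₂)^ν) and scaling by λ into multiplication by λ (by 1), and
-- is multiplicative; w is recovered from the two forms since θ₁ - θ₂ is invertible, and solutions with
-- prescribed initial values exist because Q is a unit.  Over ℤ_(p) the roots are p-integral and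
-- (θ₁ - θ₂)² = D, so θ₁ - θ₂ is a unit times p^(s/2) and the images are the units ≡ 1 mod p^(s/2).
-- Over 𝔽_p with p ∣ D the root θ is double, every solution is θⁿ(a + nb), and as n runs through all
-- residues any two solutions are equivalent.
module Submission where

open import Defs

open import Level using (0ℓ)
open import Algebra.Bundles using (CommutativeRing)
open import Algebra.Structures using (IsCommutativeRing)
import Algebra.Properties.Ring as RingProperties
import Algebra.Properties.Semiring.Mult.TCOptimised as SemiringMult
import Algebra.Solver.Ring as RingSolver
import Algebra.Solver.Ring.AlmostCommutativeRing as AlmostCommutativeRing
open import Data.Empty using (⊥-elim)
open import Data.Maybe using (Maybe; just; nothing)
open import Data.Nat as ℕ using (ℕ; zero; suc)
import Data.Nat.Properties as ℕP
import Data.Nat.Divisibility as ℕD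
import Data.Nat.DivMod as ℕDM
import Data.Nat.GCD as GCD
open import Data.Nat.Coprimality using (Coprime; coprime-Bézout; coprime-divisor)
import Data.Nat.Coprimality as Coprimality
open import Data.Nat.Induction using (<-rec)
open import Data.Nat.Primality using (Prime; euclidsLemma; prime⇒nonZero; prime⇒nonTrivial; prime⇒irreducible)
import Data.Nat.Tactic.RingSolver as ℕSolver
open import Data.Integer as ℤ using (ℤ; +_; -[1+_]; +[1+_]; _⊖_)
import Data.Integer.Properties as ℤP
import Data.Integer.Divisibility as ℤD
import Data.Integer.Divisibility.Signed as ℤS
import Data.Integer.DivMod as ℤDM
open import Data.Integer.Tactic.RingSolver using (solve-∀)
open import Data.Rational as ℚ using (ℚ; mkℚ; ↥_; ↧_; ↧ₙ_; toℚᵘ; 0ℚ; 1ℚ)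
import Data.Rational.Properties as ℚP
open import Data.Rational.Unnormalised as ℚᵘ using (mkℚᵘ; *≡*)
import Data.Rational.Unnormalised.Properties as ℚᵘP
open import Data.Product using (Σ; _×_; _,_; proj₁; proj₂)
open import Data.Sign as Sign using (Sign)
open import Data.Sum using (inj₁; inj₂)
open import Data.Unit using (⊤; tt)
open import Function.Bundles using (_⇔_; mk⇔)
open import Relation.Binary.PropositionalEquality as ≡ using (_≡_; _≢_)
import Relation.Binary.Reasoning.Setoid as SetoidReasoning
open import Relation.Nullary using (¬_; yes; no)
open import Relation.Nullary.Decidable.Core using (recompute)

module IntegerSolver (R : CommutativeRing 0ℓ 0ℓ) where
  open CommutativeRing R
  open RingProperties ring using (-‿involutive; -‿distribˡ-*; -‿distribʳ-*; -‿+-comm; -0#≈0#)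
  open SemiringMult semiring using (×-homo-+; ×1-homo-*) renaming (_×_ to _×ᵣ_)
  open SetoidReasoning setoid

  fromℤ : ℤ → Carrier
  fromℤ (+ n)    = n ×ᵣ 1#
  fromℤ -[1+ n ] = - (suc n ×ᵣ 1#)

  private
    suc×1 : ∀ n → suc n ×ᵣ 1# ≈ 1# + n ×ᵣ 1#
    suc×1 = ×-homo-+ 1# 1

    signed : Sign → Carrier → Carrier
    signed Sign.+ x = x
    signed Sign.- x = - x

    signed-cong : ∀ s {x y} → x ≈ y → signed s x ≈ signed s y
    signed-cong Sign.+ e = e
    signed-cong Sign.- e = -‿cong e

    signed-* : ∀ s t x y → signed (s Sign.* t) (x * y) ≈ signed s x * signed t y
    signed-* Sign.+ Sign.+ x y = refl
    signed-* Sign.+ Sign.- x y = -‿distribʳ-* x y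
    signed-* Sign.- Sign.+ x y = -‿distribˡ-* x y
    signed-* Sign.- Sign.- x y = begin
      x * y         ≈⟨ -‿involutive _ ⟨
      - - (x * y)   ≈⟨ -‿cong (-‿distribˡ-* x y) ⟩
      - (- x * y)   ≈⟨ -‿distribʳ-* (- x) y ⟩
      - x * - y     ∎

    fromℤ-◃ : ∀ s n → fromℤ (s ℤ.◃ n) ≈ signed s (n ×ᵣ 1#)
    fromℤ-◃ Sign.+ zero          = refl
    fromℤ-◃ Sign.- zero          = sym -0#≈0#
    fromℤ-◃ Sign.+ (suc n)       = refl
    fromℤ-◃ Sign.- (suc zero)    = refl
    fromℤ-◃ Sign.- (suc (suc n)) = refl

    fromℤ-signed : ∀ i → fromℤ i ≈ signed (ℤ.sign i) (ℤ.∣ i ∣ ×ᵣ 1#)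
    fromℤ-signed i = trans (reflexive (≡.cong fromℤ (≡.sym (ℤP.◃-inverse i)))) (fromℤ-◃ (ℤ.sign i) ℤ.∣ i ∣)

    sub-suc : ∀ x y → x - y ≈ (1# + x) - (1# + y)
    sub-suc x y = begin
      x - y                   ≈⟨ +-identityˡ _ ⟨
      0# + (x - y)            ≈⟨ +-congʳ (-‿inverseʳ 1#) ⟨
      (1# - 1#) + (x - y)     ≈⟨ +-assoc _ _ _ ⟩
      1# + (- 1# + (x - y))   ≈⟨ +-congˡ (+-assoc _ _ _) ⟨
      1# + ((- 1# + x) - y)   ≈⟨ +-congˡ (+-congʳ (+-comm _ _)) ⟩
      1# + ((x - 1#) - y)     ≈⟨ +-congˡ (+-assoc _ _ _) ⟩
      1# + (x + (- 1# - y))   ≈⟨ +-congˡ (+-congˡ (-‿+-comm _ _)) ⟩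
      1# + (x - (1# + y))     ≈⟨ +-assoc _ _ _ ⟨
      (1# + x) - (1# + y)     ∎

    fromℤ-⊖ : ∀ m n → fromℤ (m ⊖ n) ≈ m ×ᵣ 1# - n ×ᵣ 1#
    fromℤ-⊖ m zero = begin
      fromℤ (m ⊖ 0)   ≡⟨ ≡.cong fromℤ (ℤP.⊖-≥ {m} {0} ℕ.z≤n) ⟩
      m ×ᵣ 1#          ≈⟨ +-identityʳ _ ⟨
      m ×ᵣ 1# + 0#     ≈⟨ +-congˡ -0#≈0# ⟨
      m ×ᵣ 1# - 0#     ∎
    fromℤ-⊖ zero (suc n) = sym (+-identityˡ _)
    fromℤ-⊖ (suc m) (suc n) = begin
      fromℤ (suc m ⊖ suc n)                ≡⟨ ≡.cong fromℤ (ℤP.[1+m]⊖[1+n]≡m⊖n m n) ⟩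
      fromℤ (m ⊖ n)                        ≈⟨ fromℤ-⊖ m n ⟩
      m ×ᵣ 1# - n ×ᵣ 1#                      ≈⟨ sub-suc _ _ ⟩
      (1# + m ×ᵣ 1#) - (1# + n ×ᵣ 1#)        ≈⟨ +-cong (suc×1 m) (-‿cong (suc×1 n)) ⟨
      suc m ×ᵣ 1# - suc n ×ᵣ 1#              ∎

  fromℤ-neg : ∀ i → fromℤ (ℤ.- i) ≈ - fromℤ i
  fromℤ-neg (+ zero)        = sym -0#≈0#
  fromℤ-neg +[1+ n ]        = refl
  fromℤ-neg -[1+ n ]        = sym (-‿involutive _)

  fromℤ-+ : ∀ i j → fromℤ (i ℤ.+ j) ≈ fromℤ i + fromℤ j
  fromℤ-+ -[1+ m ] -[1+ n ] = begin
    - (suc (suc (m ℕ.+ n)) ×ᵣ 1#)            ≡⟨ ≡.cong (λ k → - (suc k ×ᵣ 1#)) (ℕP.+-suc m n) ⟨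
    - ((suc m ℕ.+ suc n) ×ᵣ 1#)              ≈⟨ -‿cong (×-homo-+ 1# (suc m) (suc n)) ⟩
    - (suc m ×ᵣ 1# + suc n ×ᵣ 1#)             ≈⟨ -‿+-comm _ _ ⟨
    - (suc m ×ᵣ 1#) - suc n ×ᵣ 1#             ∎
  fromℤ-+ -[1+ m ] (+ n)    = trans (fromℤ-⊖ n (suc m)) (+-comm _ _)
  fromℤ-+ (+ m)    -[1+ n ] = fromℤ-⊖ m (suc n)
  fromℤ-+ (+ m)    (+ n)    = ×-homo-+ 1# m n

  fromℤ-* : ∀ i j → fromℤ (i ℤ.* j) ≈ fromℤ i * fromℤ j
  fromℤ-* i j = begin
    fromℤ (i ℤ.* j)                                           ≈⟨ fromℤ-◃ (s Sign.* t) (ℤ.∣ i ∣ ℕ.* ℤ.∣ j ∣) ⟩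
    signed (s Sign.* t) ((ℤ.∣ i ∣ ℕ.* ℤ.∣ j ∣) ×ᵣ 1#)          ≈⟨ signed-cong (s Sign.* t) (×1-homo-* ℤ.∣ i ∣ ℤ.∣ j ∣) ⟩
    signed (s Sign.* t) ((ℤ.∣ i ∣ ×ᵣ 1#) * (ℤ.∣ j ∣ ×ᵣ 1#))     ≈⟨ signed-* s t _ _ ⟩
    signed s (ℤ.∣ i ∣ ×ᵣ 1#) * signed t (ℤ.∣ j ∣ ×ᵣ 1#)         ≈⟨ *-cong (fromℤ-signed i) (fromℤ-signed j) ⟨
    fromℤ i * fromℤ j                                         ∎
    where
    s = ℤ.sign i
    t = ℤ.sign j

  private
    fromℤ-homomorphism : ℤ.+-*-rawRing AlmostCommutativeRing.-Raw-AlmostCommutative⟶ AlmostCommutativeRing.fromCommutativeRing R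
    fromℤ-homomorphism = record
      { ⟦_⟧ = fromℤ ; +-homo = fromℤ-+ ; *-homo = fromℤ-* ; -‿homo = fromℤ-neg ; 0-homo = refl ; 1-homo = refl }

    fromℤ-≟ : ∀ i j → Maybe (fromℤ i ≈ fromℤ j)
    fromℤ-≟ i j with i ℤ.≟ j
    ... | yes ≡.refl = just refl
    ... | no _       = nothing

  open RingSolver ℤ.+-*-rawRing (AlmostCommutativeRing.fromCommutativeRing R) fromℤ-homomorphism fromℤ-≟ public

IsCommutativeRng : Rng → Set
IsCommutativeRng K = IsCommutativeRing _≈_ _+_ _*_ -_ 0# 1#
  where open Rng K

+1-pos : ∀ k → + k ℤ.+ + 1 ≡ + suc k
+1-pos k = ≡.cong +_ (ℕP.+-comm k 1)

private
  +1-neg : ∀ k → ℤ.- (+ suc k) ℤ.+ + 1 ≡ ℤ.- (+ k)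
  +1-neg zero    = ≡.refl
  +1-neg (suc k) = ≡.refl

  +2≡+1+1 : ∀ n → n ℤ.+ + 2 ≡ (n ℤ.+ + 1) ℤ.+ + 1
  +2≡+1+1 n = ≡.sym (ℤP.+-assoc n (+ 1) (+ 1))

  +suc≡++1 : ∀ n k → n ℤ.+ + suc k ≡ (n ℤ.+ + k) ℤ.+ + 1
  +suc≡++1 n k = ≡.trans (≡.cong (λ z → n ℤ.+ z) (≡.sym (+1-pos k))) (≡.sym (ℤP.+-assoc n (+ k) (+ 1)))

  +-swap : ∀ n m ν → (n ℤ.+ m) ℤ.+ ν ≡ (n ℤ.+ ν) ℤ.+ m
  +-swap n m ν = ≡.trans (ℤP.+-assoc n m ν) (≡.trans (≡.cong (λ z → n ℤ.+ z) (ℤP.+-comm m ν)) (≡.sym (ℤP.+-assoc n ν m)))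

module CRing (K : Rng) (isCR : IsCommutativeRng K) where
  open Rng K public
  commutativeRing : CommutativeRing 0ℓ 0ℓ
  commutativeRing = record { isCommutativeRing = isCR }
  open CommutativeRing commutativeRing public
    using (refl; sym; trans; reflexive; setoid; +-cong; *-cong; -‿cong; +-congˡ; +-congʳ; *-congˡ; *-congʳ;
           *-comm; *-assoc; +-comm; +-assoc; *-identityˡ; *-identityʳ; +-identityˡ; +-identityʳ; -‿inverseʳ; zeroˡ; zeroʳ)
  open IntegerSolver commutativeRing public using (fromℤ; fromℤ-+; solve; _:+_; _:*_; :-_; _:-_; _:=_; con)
  open SetoidReasoning setoid public

  ≈-at : ∀ (w : ℤ → Carrier) {i j} → i ≡ j → w i ≈ w j
  ≈-at w e = reflexive (≡.cong w e)

  ^-cong : ∀ {a b} k → a ≈ b → a ^ k ≈ b ^ k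
  ^-cong zero    e = refl
  ^-cong (suc k) e = *-cong e (^-cong k e)

  ^-distrib-* : ∀ a b k → (a ^ k) * (b ^ k) ≈ (a * b) ^ k
  ^-distrib-* a b zero    = *-identityˡ 1#
  ^-distrib-* a b (suc k) =
    trans (solve 4 (λ a b x y → (a :* x) :* (b :* y) := (a :* b) :* (x :* y)) refl a b (a ^ k) (b ^ k))
          (*-congˡ (^-distrib-* a b k))

  1^ : ∀ k → 1# ^ k ≈ 1#
  1^ zero    = refl
  1^ (suc k) = trans (*-identityˡ _) (1^ k)

  ^-inverse : ∀ {a b} k → a * b ≈ 1# → (a ^ k) * (b ^ k) ≈ 1#
  ^-inverse {a} {b} k e = trans (^-distrib-* a b k) (trans (^-cong k e) (1^ k))

  inverse-* : ∀ {a a⁻¹ b b⁻¹} → a * a⁻¹ ≈ 1# → b * b⁻¹ ≈ 1# → (a * b) * (a⁻¹ * b⁻¹) ≈ 1#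
  inverse-* {a} {a⁻¹} {b} {b⁻¹} e f =
    trans (solve 4 (λ a a' b b' → (a :* b) :* (a' :* b') := (a :* a') :* (b :* b')) refl a a⁻¹ b b⁻¹)
          (trans (*-cong e f) (*-identityˡ 1#))

  *-cancelʳ-unit : ∀ {a b u u⁻¹} → a * u ≈ b * u → u * u⁻¹ ≈ 1# → a ≈ b
  *-cancelʳ-unit {a} {b} {u} {u⁻¹} e i = begin
    a                ≈⟨ trans (*-congˡ i) (*-identityʳ a) ⟨
    a * (u * u⁻¹)    ≈⟨ *-assoc _ _ _ ⟨
    (a * u) * u⁻¹    ≈⟨ *-congʳ e ⟩
    (b * u) * u⁻¹    ≈⟨ *-assoc _ _ _ ⟩
    b * (u * u⁻¹)    ≈⟨ trans (*-congˡ i) (*-identityʳ b) ⟩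
    b                ∎

  *-cancelˡ-unit : ∀ {a b u u⁻¹} → u * a ≈ u * b → u * u⁻¹ ≈ 1# → a ≈ b
  *-cancelˡ-unit e = *-cancelʳ-unit (trans (*-comm _ _) (trans e (*-comm _ _)))

  record Subring (S : Carrier → Set) : Set where
    field
      ∈-resp-≈ : ∀ {x y} → x ≈ y → S x → S y
      +-closed : ∀ {x y} → S x → S y → S (x + y)
      *-closed : ∀ {x y} → S x → S y → S (x * y)
      -‿closed : ∀ {x} → S x → S (- x)
      0-closed : S 0#
      1-closed : S 1#

    ^-closed : ∀ {x} → S x → ∀ k → S (x ^ k)
    ^-closed sx zero    = 1-closed
    ^-closed sx (suc k) = *-closed sx (^-closed sx k)

  Recurrence : Carrier → Carrier → (ℤ → Carrier) → Set
  Recurrence p q w = ∀ n → w (n ℤ.+ + 2) ≈ p * w (n ℤ.+ + 1) - q * w n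

  recurrence-backward : ∀ {p q q⁻¹ w} → q * q⁻¹ ≈ 1# → Recurrence p q w →
                        ∀ n → w n ≈ q⁻¹ * (p * w (n ℤ.+ + 1) - w (n ℤ.+ + 2))
  recurrence-backward {p} {q} {q⁻¹} {w} e r n = begin
    w n                                                ≈⟨ trans (*-congʳ (trans (*-comm _ _) e)) (*-identityˡ _) ⟨
    (q⁻¹ * q) * w n                                    ≈⟨ solve 5 (λ i q a b c → (i :* q) :* a := i :* (b :- (b :- q :* a))) refl q⁻¹ q (w n) (p * w (n ℤ.+ + 1)) (w (n ℤ.+ + 2)) ⟩
    q⁻¹ * (p * w (n ℤ.+ + 1) - (p * w (n ℤ.+ + 1) - q * w n)) ≈⟨ *-congˡ (+-congˡ (-‿cong (r n))) ⟨
    q⁻¹ * (p * w (n ℤ.+ + 1) - w (n ℤ.+ + 2))          ∎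

  module _ {p q q⁻¹ : Carrier} (e : q * q⁻¹ ≈ 1#) {u v : ℤ → Carrier} (ru : Recurrence p q u) (rv : Recurrence p q v) where
    private
      AgreeAt : ℤ → Set
      AgreeAt n = (u n ≈ v n) × (u (n ℤ.+ + 1) ≈ v (n ℤ.+ + 1))

      agree-subst : ∀ {i j} → i ≡ j → AgreeAt i → AgreeAt j
      agree-subst ≡.refl x = x

      agree-forward : ∀ n → AgreeAt n → AgreeAt (n ℤ.+ + 1)
      agree-forward n (a , b) = b , (begin
        u ((n ℤ.+ + 1) ℤ.+ + 1)     ≈⟨ ≈-at u (+2≡+1+1 n) ⟨
        u (n ℤ.+ + 2)               ≈⟨ ru n ⟩
        p * u (n ℤ.+ + 1) - q * u n ≈⟨ +-cong (*-congˡ b) (-‿cong (*-congˡ a)) ⟩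
        p * v (n ℤ.+ + 1) - q * v n ≈⟨ rv n ⟨
        v (n ℤ.+ + 2)               ≈⟨ ≈-at v (+2≡+1+1 n) ⟩
        v ((n ℤ.+ + 1) ℤ.+ + 1)     ∎)

      agree-backward : ∀ n → AgreeAt (n ℤ.+ + 1) → AgreeAt n
      agree-backward n (a , b) = (begin
        u n                                           ≈⟨ recurrence-backward e ru n ⟩
        q⁻¹ * (p * u (n ℤ.+ + 1) - u (n ℤ.+ + 2))     ≈⟨ *-congˡ (+-cong (*-congˡ a) (-‿cong u₂≈v₂)) ⟩
        q⁻¹ * (p * v (n ℤ.+ + 1) - v (n ℤ.+ + 2))     ≈⟨ recurrence-backward e rv n ⟨
        v n                                           ∎) , a
        where
        u₂≈v₂ : u (n ℤ.+ + 2) ≈ v (n ℤ.+ + 2)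
        u₂≈v₂ = trans (≈-at u (+2≡+1+1 n)) (trans b (≈-at v (≡.sym (+2≡+1+1 n))))

      agree-pos : AgreeAt (+ 0) → ∀ k → AgreeAt (+ k)
      agree-pos h zero    = h
      agree-pos h (suc k) = agree-subst (+1-pos k) (agree-forward (+ k) (agree-pos h k))

      agree-neg : AgreeAt (+ 0) → ∀ k → AgreeAt (ℤ.- (+ k))
      agree-neg h zero    = h
      agree-neg h (suc k) = agree-backward (ℤ.- + suc k) (agree-subst (≡.sym (+1-neg k)) (agree-neg h k))

    solutions-agree : u (+ 0) ≈ v (+ 0) → u (+ 1) ≈ v (+ 1) → ∀ n → u n ≈ v n
    solutions-agree a b (+ k)    = proj₁ (agree-pos (a , b) k)
    solutions-agree a b -[1+ k ] = proj₁ (agree-neg (a , b) (suc k))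

  Recurrence-scaled-shift : ∀ {p q v} c ν → Recurrence p q v → Recurrence p q (λ n → c * v (n ℤ.+ ν))
  Recurrence-scaled-shift {p} {q} {v} c ν r n = begin
    c * v ((n ℤ.+ + 2) ℤ.+ ν)                                 ≈⟨ *-congˡ (≈-at v (+-swap n (+ 2) ν)) ⟩
    c * v ((n ℤ.+ ν) ℤ.+ + 2)                                 ≈⟨ *-congˡ (r (n ℤ.+ ν)) ⟩
    c * (p * v ((n ℤ.+ ν) ℤ.+ + 1) - q * v (n ℤ.+ ν))         ≈⟨ *-congˡ (+-congʳ (*-congˡ (≈-at v (+-swap n (+ 1) ν)))) ⟨
    c * (p * v ((n ℤ.+ + 1) ℤ.+ ν) - q * v (n ℤ.+ ν))         ≈⟨ solve 5 (λ c p a q b → c :* (p :* a :- q :* b) := p :* (c :* a) :- q :* (c :* b)) refl c p _ q _ ⟩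
    p * (c * v ((n ℤ.+ + 1) ℤ.+ ν)) - q * (c * v (n ℤ.+ ν))   ∎

  ∼*-from-initial : ∀ {S P Q Q⁻¹ w v c ν} → ι Q * Q⁻¹ ≈ 1# →
    Recurrence (ι P) (ι Q) w → Recurrence (ι P) (ι Q) v → Unit K S c →
    w (+ 0) ≈ c * v ν → w (+ 1) ≈ c * v (ν ℤ.+ + 1) → Sim K S P Q w v
  ∼*-from-initial {v = v} {c} {ν} e rw rv uc w₀ w₁ =
    c , uc , ν , solutions-agree e rw (Recurrence-scaled-shift c ν rv)
                   (trans w₀ (*-congˡ (≈-at v (≡.sym (ℤP.+-identityˡ ν)))))
                   (trans w₁ (*-congˡ (≈-at v (ℤP.+-comm ν (+ 1)))))

  rootForm : Carrier → (ℤ → Carrier) → ℤ → Carrier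
  rootForm α v n = v (n ℤ.+ + 1) - v n * α

  rootForm-scaled-shift : ∀ {w v c ν} → (∀ n → w n ≈ c * v (n ℤ.+ ν)) → ∀ α → rootForm α w (+ 0) ≈ c * rootForm α v ν
  rootForm-scaled-shift {w} {v} {c} {ν} eq α = begin
    w (+ 1) - w (+ 0) * α         ≈⟨ +-cong w₁ (-‿cong (*-congʳ w₀)) ⟩
    c * v (ν ℤ.+ + 1) - (c * v ν) * α ≈⟨ solve 4 (λ c x y α → c :* x :- (c :* y) :* α := c :* (x :- y :* α)) refl c _ _ α ⟩
    c * rootForm α v ν            ∎
    where
    w₁ = trans (eq (+ 1)) (*-congˡ (≈-at v (ℤP.+-comm (+ 1) ν)))
    w₀ = trans (eq (+ 0)) (*-congˡ (≈-at v (ℤP.+-identityˡ ν)))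

  module RootForm {p q α β : Carrier} (α+β : α + β ≈ p) (αβ : α * β ≈ q) {v : ℤ → Carrier} (r : Recurrence p q v) where
    rootForm-step : ∀ n → rootForm α v (n ℤ.+ + 1) ≈ β * rootForm α v n
    rootForm-step n = begin
      v ((n ℤ.+ + 1) ℤ.+ + 1) - v (n ℤ.+ + 1) * α                 ≈⟨ +-congʳ (trans (≈-at v (≡.sym (+2≡+1+1 n))) (r n)) ⟩
      (p * v (n ℤ.+ + 1) - q * v n) - v (n ℤ.+ + 1) * α           ≈⟨ +-congʳ (+-cong (*-congʳ (sym α+β)) (-‿cong (*-congʳ (sym αβ)))) ⟩
      ((α + β) * v (n ℤ.+ + 1) - (α * β) * v n) - v (n ℤ.+ + 1) * α ≈⟨ solve 4 (λ α β a b → ((α :+ β) :* a :- (α :* β) :* b) :- a :* α := β :* (a :- b :* α)) refl α β _ _ ⟩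
      β * (v (n ℤ.+ + 1) - v n * α)                               ∎

    rootForm-shift : ∀ n k → rootForm α v (n ℤ.+ + k) ≈ (β ^ k) * rootForm α v n
    rootForm-shift n zero    = trans (≈-at (rootForm α v) (ℤP.+-identityʳ n)) (sym (*-identityˡ _))
    rootForm-shift n (suc k) = begin
      rootForm α v (n ℤ.+ + suc k)        ≈⟨ ≈-at (rootForm α v) (+suc≡++1 n k) ⟩
      rootForm α v ((n ℤ.+ + k) ℤ.+ + 1)  ≈⟨ rootForm-step (n ℤ.+ + k) ⟩
      β * rootForm α v (n ℤ.+ + k)        ≈⟨ *-congˡ (rootForm-shift n k) ⟩
      β * ((β ^ k) * rootForm α v n)      ≈⟨ *-assoc _ _ _ ⟨
      (β * (β ^ k)) * rootForm α v n      ∎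

  module InitialValues (p q q⁻¹ : Carrier) (e : q * q⁻¹ ≈ 1#) (a₀ a₁ : Carrier) where
    private
      forward : ℕ → Carrier × Carrier
      forward zero    = a₀ , a₁
      forward (suc k) = proj₂ (forward k) , p * proj₂ (forward k) - q * proj₁ (forward k)

      backward : ℕ → Carrier × Carrier
      backward zero    = a₀ , a₁
      backward (suc k) = q⁻¹ * (p * proj₁ (backward k) - proj₂ (backward k)) , proj₁ (backward k)

      step-back : ∀ x y → y ≈ x - q * (q⁻¹ * (x - y))
      step-back x y = begin
        y                                                ≈⟨ solve 3 (λ x y t → y := x :- t :* (x :- y) :+ (t :- con (+ 1)) :* (x :- y)) refl x y (q * q⁻¹) ⟩
        x - (q * q⁻¹) * (x - y) + (q * q⁻¹ - 1#) * (x - y) ≈⟨ +-congˡ (*-congʳ (trans (+-congʳ e) (-‿inverseʳ 1#))) ⟩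
        x - (q * q⁻¹) * (x - y) + 0# * (x - y)           ≈⟨ trans (+-congˡ (zeroˡ _)) (+-identityʳ _) ⟩
        x - (q * q⁻¹) * (x - y)                          ≈⟨ +-congˡ (-‿cong (*-assoc _ _ _)) ⟩
        x - q * (q⁻¹ * (x - y))                          ∎

    solution : ℤ → Carrier
    solution (+ k)    = proj₁ (forward k)
    solution -[1+ k ] = proj₁ (backward (suc k))

    solution-recurrence : Recurrence p q solution
    solution-recurrence (+ k)                = trans (≈-at solution (≡.cong +_ (ℕP.+-comm k 2))) (+-congʳ (*-congˡ (≈-at solution (≡.sym (+1-pos k)))))
    solution-recurrence -[1+ zero ]          = step-back (p * a₀) a₁
    solution-recurrence -[1+ suc zero ]      = step-back (p * proj₁ (backward 1)) (proj₂ (backward 1))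
    solution-recurrence -[1+ suc (suc k) ]   = step-back (p * proj₁ (backward (suc (suc k)))) (proj₂ (backward (suc (suc k))))

    module _ {S : Carrier → Set} (sr : Subring S) (sp : S p) (sq : S q) (sq⁻¹ : S q⁻¹) (sa₀ : S a₀) (sa₁ : S a₁) where
      open Subring sr
      private
        forward-∈ : ∀ k → S (proj₁ (forward k)) × S (proj₂ (forward k))
        forward-∈ zero    = sa₀ , sa₁
        forward-∈ (suc k) = proj₂ (forward-∈ k) , +-closed (*-closed sp (proj₂ (forward-∈ k))) (-‿closed (*-closed sq (proj₁ (forward-∈ k))))

        backward-∈ : ∀ k → S (proj₁ (backward k)) × S (proj₂ (backward k))
        backward-∈ zero    = sa₀ , sa₁
        backward-∈ (suc k) = *-closed sq⁻¹ (+-closed (*-closed sp (proj₁ (backward-∈ k))) (-‿closed (proj₂ (backward-∈ k)))) , proj₁ (backward-∈ k)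

      solution-∈ : ∀ n → S (solution n)
      solution-∈ (+ k)    = proj₁ (forward-∈ k)
      solution-∈ -[1+ k ] = proj₁ (backward-∈ (suc k))

  roots-difference² : ∀ {S P Q θ₁ θ₂} → Roots K S P Q θ₁ θ₂ → (θ₁ - θ₂) * (θ₁ - θ₂) ≈ ι P * ι P - fromℤ (+ 4) * ι Q
  roots-difference² {P = P} {Q} {θ₁} {θ₂} (θ₁+θ₂ , θ₁θ₂) = begin
    (θ₁ - θ₂) * (θ₁ - θ₂)                              ≈⟨ solve 2 (λ a b → (a :- b) :* (a :- b) := (a :+ b) :* (a :+ b) :- con (+ 4) :* (a :* b)) refl θ₁ θ₂ ⟩
    (θ₁ + θ₂) * (θ₁ + θ₂) - fromℤ (+ 4) * (θ₁ * θ₂)    ≈⟨ +-cong (*-cong θ₁+θ₂ θ₁+θ₂) (-‿cong (*-congˡ θ₁θ₂)) ⟩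
    ι P * ι P - fromℤ (+ 4) * ι Q                        ∎

Ext-isCommutativeRng : ∀ K → IsCommutativeRng K → ∀ P Q → IsCommutativeRng (Ext K P Q)
Ext-isCommutativeRng K isCR P Q = record
  { isRing = record
    { +-isAbelianGroup = record
      { isGroup = record
        { isMonoid = record
          { isSemigroup = record
            { isMagma = record
              { isEquivalence = record { refl = refl , refl ; sym = λ (x , y) → sym x , sym y ; trans = λ (x , y) (u , v) → trans x u , trans y v }
              ; ∙-cong = λ (x , y) (u , v) → +-cong x u , +-cong y v }
            ; assoc = λ x y z → +-assoc _ _ _ , +-assoc _ _ _ }
          ; identity = (λ x → +-identityˡ _ , +-identityˡ _) , (λ x → +-identityʳ _ , +-identityʳ _) }
        ; inverse = (λ x → trans (+-comm _ _) (-‿inverseʳ _) , trans (+-comm _ _) (-‿inverseʳ _)) , (λ x → -‿inverseʳ _ , -‿inverseʳ _)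
        ; ⁻¹-cong = λ (x , y) → -‿cong x , -‿cong y }
      ; comm = λ x y → +-comm _ _ , +-comm _ _ }
    ; *-cong = λ (x , y) (u , v) → +-cong (*-cong x u) (-‿cong (*-congˡ (*-cong y v))) , +-cong (+-cong (*-cong x v) (*-cong y u)) (*-congˡ (*-cong y v))
    ; *-assoc = λ x y z →
        solve 8 (λ a b c d e f p q → (a :* c :- q :* (b :* d)) :* e :- q :* ((a :* d :+ b :* c :+ p :* (b :* d)) :* f)
                   := a :* (c :* e :- q :* (d :* f)) :- q :* (b :* (c :* f :+ d :* e :+ p :* (d :* f)))) refl
                (proj₁ x) (proj₂ x) (proj₁ y) (proj₂ y) (proj₁ z) (proj₂ z) p q
      , solve 8 (λ a b c d e f p q → (a :* c :- q :* (b :* d)) :* f :+ (a :* d :+ b :* c :+ p :* (b :* d)) :* e :+ p :* ((a :* d :+ b :* c :+ p :* (b :* d)) :* f)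
                   := a :* (c :* f :+ d :* e :+ p :* (d :* f)) :+ b :* (c :* e :- q :* (d :* f)) :+ p :* (b :* (c :* f :+ d :* e :+ p :* (d :* f)))) refl
                (proj₁ x) (proj₂ x) (proj₁ y) (proj₂ y) (proj₁ z) (proj₂ z) p q
    ; *-identity =
        (λ x → solve 4 (λ a b p q → con (+ 1) :* a :- q :* (con (+ 0) :* b) := a) refl (proj₁ x) (proj₂ x) p q
             , solve 4 (λ a b p q → con (+ 1) :* b :+ con (+ 0) :* a :+ p :* (con (+ 0) :* b) := b) refl (proj₁ x) (proj₂ x) p q)
      , (λ x → solve 4 (λ a b p q → a :* con (+ 1) :- q :* (b :* con (+ 0)) := a) refl (proj₁ x) (proj₂ x) p q
             , solve 4 (λ a b p q → a :* con (+ 0) :+ b :* con (+ 1) :+ p :* (b :* con (+ 0)) := b) refl (proj₁ x) (proj₂ x) p q)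
    ; distrib =
        (λ x y z → solve 8 (λ a b c d e f p q → a :* (c :+ e) :- q :* (b :* (d :+ f)) := (a :* c :- q :* (b :* d)) :+ (a :* e :- q :* (b :* f))) refl
                (proj₁ x) (proj₂ x) (proj₁ y) (proj₂ y) (proj₁ z) (proj₂ z) p q
                 , solve 8 (λ a b c d e f p q → a :* (d :+ f) :+ b :* (c :+ e) :+ p :* (b :* (d :+ f)) := (a :* d :+ b :* c :+ p :* (b :* d)) :+ (a :* f :+ b :* e :+ p :* (b :* f))) refl
                (proj₁ x) (proj₂ x) (proj₁ y) (proj₂ y) (proj₁ z) (proj₂ z) p q)
      , (λ x y z → solve 8 (λ a b c d e f p q → (c :+ e) :* a :- q :* ((d :+ f) :* b) := (c :* a :- q :* (d :* b)) :+ (e :* a :- q :* (f :* b))) refl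
                (proj₁ x) (proj₂ x) (proj₁ y) (proj₂ y) (proj₁ z) (proj₂ z) p q
                 , solve 8 (λ a b c d e f p q → (c :+ e) :* b :+ (d :+ f) :* a :+ p :* ((d :+ f) :* b) := (c :* b :+ d :* a :+ p :* (d :* b)) :+ (e :* b :+ f :* a :+ p :* (f :* b))) refl
                (proj₁ x) (proj₂ x) (proj₁ y) (proj₂ y) (proj₁ z) (proj₂ z) p q)
    }
  ; *-comm = λ x y →
        solve 6 (λ a b c d p q → a :* c :- q :* (b :* d) := c :* a :- q :* (d :* b)) refl (proj₁ x) (proj₂ x) (proj₁ y) (proj₂ y) p q
      , solve 6 (λ a b c d p q → a :* d :+ b :* c :+ p :* (b :* d) := c :* b :+ d :* a :+ p :* (d :* b)) refl (proj₁ x) (proj₂ x) (proj₁ y) (proj₂ y) p q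
  }
  where
  open CRing K isCR
  p = ι P
  q = ι Q

module SplitCase (K : Rng) (isCR : IsCommutativeRng K) (S : Rng.Carrier K → Set) (sr : CRing.Subring K isCR S)
  (P Q : ℤ) (sP : S (Rng.ι K P)) (uQ : Unit K S (Rng.ι K Q))
  (θ₁ θ₂ r : Rng.Carrier K) (sθ₁ : S θ₁) (sθ₂ : S θ₂) (roots : Roots K S P Q θ₁ θ₂) (rθ₂≈θ₁ : Rng._≈_ K (Rng._*_ K r θ₂) θ₁)
  (d⁻¹ : Rng.Carrier K) (dd⁻¹ : Rng._≈_ K (Rng._*_ K (Rng._-_ K θ₁ θ₂) d⁻¹) (Rng.1# K))
  where
  open CRing K isCR
  open Subring sr

  private
    sQ = proj₁ uQ
    Q⁻¹ = proj₁ (proj₂ uQ)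
    sQ⁻¹ = proj₁ (proj₂ (proj₂ uQ))
    QQ⁻¹ = proj₂ (proj₂ (proj₂ uQ))

    θ₁+θ₂ : θ₁ + θ₂ ≈ ι P
    θ₁+θ₂ = proj₁ roots
    θ₁θ₂ : θ₁ * θ₂ ≈ ι Q
    θ₁θ₂ = proj₂ roots
    θ₂+θ₁ : θ₂ + θ₁ ≈ ι P
    θ₂+θ₁ = trans (+-comm _ _) θ₁+θ₂
    θ₂θ₁ : θ₂ * θ₁ ≈ ι Q
    θ₂θ₁ = trans (*-comm _ _) θ₁θ₂

    θ₁⁻¹ θ₂⁻¹ : Carrier
    θ₁⁻¹ = θ₂ * Q⁻¹
    θ₂⁻¹ = θ₁ * Q⁻¹

    θ₁θ₁⁻¹ : θ₁ * θ₁⁻¹ ≈ 1#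
    θ₁θ₁⁻¹ = trans (sym (*-assoc _ _ _)) (trans (*-congʳ θ₁θ₂) QQ⁻¹)
    θ₂θ₂⁻¹ : θ₂ * θ₂⁻¹ ≈ 1#
    θ₂θ₂⁻¹ = trans (sym (*-assoc _ _ _)) (trans (*-congʳ θ₂θ₁) QQ⁻¹)

    r^θ₂^≈θ₁^ : ∀ k → (r ^ k) * (θ₂ ^ k) ≈ θ₁ ^ k
    r^θ₂^≈θ₁^ k = trans (^-distrib-* r θ₂ k) (^-cong k rθ₂≈θ₁)

    module R₁ {v : ℤ → Carrier} (rv : Recurrence (ι P) (ι Q) v) = RootForm θ₁+θ₂ θ₁θ₂ rv
    module R₂ {v : ℤ → Carrier} (rv : Recurrence (ι P) (ι Q) v) = RootForm θ₂+θ₁ θ₂θ₁ rv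

  form₁ form₂ : (ℤ → Carrier) → Carrier
  form₁ w = rootForm θ₁ w (+ 0)
  form₂ w = rootForm θ₂ w (+ 0)

  norm≈form₁*form₂ : ∀ w → w (+ 1) * w (+ 1) - ι P * w (+ 0) * w (+ 1) + ι Q * w (+ 0) * w (+ 0) ≈ form₁ w * form₂ w
  norm≈form₁*form₂ w = begin
    w (+ 1) * w (+ 1) - ι P * w (+ 0) * w (+ 1) + ι Q * w (+ 0) * w (+ 0)
      ≈⟨ +-cong (+-congˡ (-‿cong (*-congʳ (*-congʳ (sym θ₁+θ₂))))) (*-congʳ (*-congʳ (sym θ₁θ₂))) ⟩
    w (+ 1) * w (+ 1) - (θ₁ + θ₂) * w (+ 0) * w (+ 1) + (θ₁ * θ₂) * w (+ 0) * w (+ 0)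
      ≈⟨ solve 4 (λ x y t u → x :* x :- (t :+ u) :* y :* x :+ (t :* u) :* y :* y := (x :- y :* t) :* (x :- y :* u)) refl (w (+ 1)) (w (+ 0)) θ₁ θ₂ ⟩
    form₁ w * form₂ w ∎

  rootForm-∈ : ∀ {w α} → (∀ n → S (w n)) → S α → ∀ n → S (rootForm α w n)
  rootForm-∈ sw sα n = +-closed (sw _) (-‿closed (*-closed (sw n) sα))

  record Solution (w : ℤ → Carrier) : Set where
    field
      ∈S         : ∀ n → S (w n)
      recurrence : Recurrence (ι P) (ι Q) w
      form₁⁻¹ form₂⁻¹ : Carrier
      form₁⁻¹∈S  : S form₁⁻¹
      form₂⁻¹∈S  : S form₂⁻¹
      form₁-inv  : form₁ w * form₁⁻¹ ≈ 1#
      form₂-inv  : form₂ w * form₂⁻¹ ≈ 1#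

  -- The norm is the product of the two forms, so both are units whenever the norm is.
  toSolution : ∀ {w} → IsSeq K S P Q w → Solution w
  toSolution {w} (sw , rw , (_ , m , sm , em)) = record
    { ∈S = sw ; recurrence = rw ; form₁⁻¹ = form₂ w * m ; form₂⁻¹ = form₁ w * m
    ; form₁⁻¹∈S = *-closed (rootForm-∈ sw sθ₂ (+ 0)) sm ; form₂⁻¹∈S = *-closed (rootForm-∈ sw sθ₁ (+ 0)) sm
    ; form₁-inv = trans (sym (*-assoc _ _ _)) (trans (*-congʳ (sym (norm≈form₁*form₂ w))) em)
    ; form₂-inv = trans (sym (*-assoc _ _ _)) (trans (*-congʳ (trans (*-comm _ _) (sym (norm≈form₁*form₂ w)))) em) }

  rootForm₂-invertible : ∀ {v} → Solution v → ∀ ν → Σ Carrier (λ u → S u × (rootForm θ₂ v ν * u ≈ 1#))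
  rootForm₂-invertible {v} sv (+ k) = (θ₁⁻¹ ^ k) * form₂⁻¹ , *-closed (^-closed (*-closed sθ₂ sQ⁻¹) k) form₂⁻¹∈S , (begin
      rootForm θ₂ v (+ 0 ℤ.+ + k) * ((θ₁⁻¹ ^ k) * form₂⁻¹) ≈⟨ *-congʳ (R₂.rootForm-shift recurrence (+ 0) k) ⟩
      ((θ₁ ^ k) * form₂ v) * ((θ₁⁻¹ ^ k) * form₂⁻¹)      ≈⟨ inverse-* (^-inverse k θ₁θ₁⁻¹) form₂-inv ⟩
      1#                                                  ∎)
    where open Solution sv
  rootForm₂-invertible {v} sv -[1+ k ] = (θ₁ ^ suc k) * form₂⁻¹ , *-closed (^-closed sθ₁ (suc k)) form₂⁻¹∈S , (begin
      rootForm θ₂ v ν * ((θ₁ ^ suc k) * form₂⁻¹)   ≈⟨ solve 3 (λ x y z → x :* (y :* z) := (y :* x) :* z) refl _ _ _ ⟩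
      ((θ₁ ^ suc k) * rootForm θ₂ v ν) * form₂⁻¹   ≈⟨ *-congʳ (R₂.rootForm-shift recurrence ν (suc k)) ⟨
      rootForm θ₂ v (ν ℤ.+ + suc k) * form₂⁻¹      ≈⟨ *-congʳ (≈-at (rootForm θ₂ v) (ℤP.+-inverseˡ (+ suc k))) ⟩
      form₂ v * form₂⁻¹                            ≈⟨ form₂-inv ⟩
      1#                                           ∎)
    where
    open Solution sv
    ν = -[1+ k ]

  -- x is the image of the shifted sequence n ↦ v (n + ν); the image of v itself is the case ν = 0.
  Related : (ℤ → Carrier) → Carrier → ℤ → Set
  Related v x ν = x * rootForm θ₂ v ν ≈ rootForm θ₁ v ν

  Related-resp : ∀ {v x y ν} → x ≈ y → Related v x ν → Related v y ν
  Related-resp x≈y rel = trans (*-congʳ (sym x≈y)) rel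

  related-unique : ∀ {v x y} → Solution v → ∀ ν → Related v x ν → Related v y ν → x ≈ y
  related-unique sv ν relx rely = *-cancelʳ-unit (trans relx (sym rely)) (proj₂ (proj₂ (rootForm₂-invertible sv ν)))

  module _ {v : ℤ → Carrier} (rv : Recurrence (ι P) (ι Q) v) (x : Carrier) (n : ℤ) (k : ℕ) where
    private
      scaled : x * rootForm θ₂ v (n ℤ.+ + k) ≈ (θ₂ ^ k) * ((r ^ k * x) * rootForm θ₂ v n)
      scaled = begin
        x * rootForm θ₂ v (n ℤ.+ + k)                 ≈⟨ *-congˡ (R₂.rootForm-shift rv n k) ⟩
        x * ((θ₁ ^ k) * rootForm θ₂ v n)              ≈⟨ *-congˡ (*-congʳ (r^θ₂^≈θ₁^ k)) ⟨
        x * (((r ^ k) * (θ₂ ^ k)) * rootForm θ₂ v n)  ≈⟨ solve 4 (λ x a b c → x :* ((a :* b) :* c) := b :* ((a :* x) :* c)) refl x (r ^ k) (θ₂ ^ k) _ ⟩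
        (θ₂ ^ k) * ((r ^ k * x) * rootForm θ₂ v n)    ∎

    related-shiftʳ : Related v x (n ℤ.+ + k) → Related v (r ^ k * x) n
    related-shiftʳ rel = *-cancelˡ-unit (trans (sym scaled) (trans rel (R₁.rootForm-shift rv n k))) (^-inverse k θ₂θ₂⁻¹)

    related-shiftˡ : Related v (r ^ k * x) n → Related v x (n ℤ.+ + k)
    related-shiftˡ rel = trans scaled (trans (*-congˡ rel) (sym (R₁.rootForm-shift rv n k)))

  ∼*⇒related : ∀ {w v x} → Related w x (+ 0) → Sim K S P Q w v → Σ ℤ (Related v x)
  ∼*⇒related {w} {v} {x} img (c , (_ , c⁻¹ , _ , cc⁻¹) , ν , w≈cv) = ν , *-cancelˡ-unit (begin
      c * (x * rootForm θ₂ v ν)   ≈⟨ solve 3 (λ c x y → c :* (x :* y) := x :* (c :* y)) refl c x _ ⟩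
      x * (c * rootForm θ₂ v ν)   ≈⟨ *-congˡ (rootForm-scaled-shift {w} {v} {c} {ν} w≈cv θ₂) ⟨
      x * form₂ w                 ≈⟨ img ⟩
      form₁ w                     ≈⟨ rootForm-scaled-shift {w} {v} {c} {ν} w≈cv θ₁ ⟩
      c * rootForm θ₁ v ν         ∎) cc⁻¹

  related⇒coset : ∀ {v x y} → Solution v → Related v y (+ 0) → ∀ ν → Related v x ν → QRel K (InCyc K r) x y
  related⇒coset {v} {x} {y} sv img (+ k) rel = r⁻¹ ^ k , (k , inj₂ r⁻¹^r^) , (begin
      x                          ≈⟨ *-identityˡ x ⟨
      1# * x                     ≈⟨ *-congʳ r⁻¹^r^ ⟨
      ((r⁻¹ ^ k) * (r ^ k)) * x  ≈⟨ *-assoc _ _ _ ⟩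
      (r⁻¹ ^ k) * (r ^ k * x)    ≈⟨ *-congˡ (related-unique sv (+ 0) (related-shiftʳ (Solution.recurrence sv) x (+ 0) k rel) img) ⟩
      (r⁻¹ ^ k) * y              ∎)
    where
    r⁻¹ = θ₂ * θ₁⁻¹
    r⁻¹^r^ : (r⁻¹ ^ k) * (r ^ k) ≈ 1#
    r⁻¹^r^ = begin
      (r⁻¹ ^ k) * (r ^ k)               ≈⟨ *-comm _ _ ⟩
      (r ^ k) * (r⁻¹ ^ k)               ≈⟨ ^-distrib-* r r⁻¹ k ⟩
      (r * (θ₂ * θ₁⁻¹)) ^ k             ≈⟨ ^-cong k (trans (sym (*-assoc _ _ _)) (*-congʳ rθ₂≈θ₁)) ⟩
      (θ₁ * θ₁⁻¹) ^ k                   ≈⟨ trans (^-cong k θ₁θ₁⁻¹) (1^ k) ⟩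
      1#                                ∎
  related⇒coset {v} {x} {y} sv img ν@(-[1+ k ]) rel = r ^ suc k , (suc k , inj₁ refl) ,
    related-unique sv ν rel (related-shiftʳ (Solution.recurrence sv) y ν (suc k) img′)
    where
    img′ : Related v y (ν ℤ.+ + suc k)
    img′ = ≡.subst (Related v y) (≡.sym (ℤP.+-inverseˡ (+ suc k))) img

  coset⇒related : ∀ {v x y} → Recurrence (ι P) (ι Q) v → Related v y (+ 0) → QRel K (InCyc K r) x y → Σ ℤ (Related v x)
  coset⇒related {v} {x} {y} rv img (h , (k , inj₁ h≈r^k) , x≈hy) =
    ℤ.- (+ k) , Related-resp {v} {ν = ℤ.- (+ k)} (sym (trans x≈hy (*-congʳ h≈r^k))) (related-shiftʳ rv y (ℤ.- (+ k)) k img′)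
    where
    img′ : Related v y (ℤ.- (+ k) ℤ.+ + k)
    img′ = ≡.subst (Related v y) (≡.sym (ℤP.+-inverseˡ (+ k))) img
  coset⇒related {v} {x} {y} rv img (h , (k , inj₂ hr^k) , x≈hy) =
    + k , related-shiftˡ rv x (+ 0) k (Related-resp {v} {ν = + 0} r^kx≈y img)
    where
    r^kx≈y : y ≈ r ^ k * x
    r^kx≈y = begin
      y                     ≈⟨ *-identityˡ y ⟨
      1# * y                ≈⟨ *-congʳ (trans (*-comm _ _) hr^k) ⟨
      ((r ^ k) * h) * y     ≈⟨ *-assoc _ _ _ ⟩
      (r ^ k) * (h * y)     ≈⟨ *-congˡ x≈hy ⟨
      r ^ k * x             ∎

  initial-from-forms : ∀ {w v c ν} → form₁ w ≈ c * rootForm θ₁ v ν → form₂ w ≈ c * rootForm θ₂ v ν →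
                       (w (+ 0) ≈ c * v ν) × (w (+ 1) ≈ c * v (ν ℤ.+ + 1))
  initial-from-forms {w} {v} {c} {ν} f₁ f₂ = w₀ , w₁
    where
    w₀ : w (+ 0) ≈ c * v ν
    w₀ = *-cancelʳ-unit (begin
      w (+ 0) * (θ₁ - θ₂)                    ≈⟨ solve 4 (λ w1 w0 t1 t2 → w0 :* (t1 :- t2) := (w1 :- w0 :* t2) :- (w1 :- w0 :* t1)) refl (w (+ 1)) (w (+ 0)) θ₁ θ₂ ⟩
      form₂ w - form₁ w                      ≈⟨ +-cong f₂ (-‿cong f₁) ⟩
      c * rootForm θ₂ v ν - c * rootForm θ₁ v ν ≈⟨ solve 5 (λ c v1 v0 t1 t2 → c :* (v1 :- v0 :* t2) :- c :* (v1 :- v0 :* t1) := (c :* v0) :* (t1 :- t2)) refl c (v (ν ℤ.+ + 1)) (v ν) θ₁ θ₂ ⟩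
      (c * v ν) * (θ₁ - θ₂)                  ∎) dd⁻¹
    w₁ : w (+ 1) ≈ c * v (ν ℤ.+ + 1)
    w₁ = begin
      w (+ 1)                                ≈⟨ solve 3 (λ w1 w0 t → w1 := (w1 :- w0 :* t) :+ w0 :* t) refl (w (+ 1)) (w (+ 0)) θ₂ ⟩
      form₂ w + w (+ 0) * θ₂                 ≈⟨ +-cong f₂ (*-congʳ w₀) ⟩
      c * rootForm θ₂ v ν + (c * v ν) * θ₂   ≈⟨ solve 4 (λ c v1 v0 t → c :* (v1 :- v0 :* t) :+ (c :* v0) :* t := c :* v1) refl c (v (ν ℤ.+ + 1)) (v ν) θ₂ ⟩
      c * v (ν ℤ.+ + 1)                      ∎

  related⇒∼* : ∀ {w v x} → Solution w → Solution v → Related w x (+ 0) → ∀ ν → Related v x ν → Sim K S P Q w v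
  related⇒∼* {w} {v} {x} sw sv img ν rel =
    ∼*-from-initial QQ⁻¹ W.recurrence V.recurrence (c∈S , c⁻¹ , c⁻¹∈S , cc⁻¹) (proj₁ initial) (proj₂ initial)
    where
    module W = Solution sw
    module V = Solution sv
    B = rootForm θ₂ v ν
    B⁻¹ = proj₁ (rootForm₂-invertible sv ν)
    BB⁻¹ : B * B⁻¹ ≈ 1#
    BB⁻¹ = proj₂ (proj₂ (rootForm₂-invertible sv ν))
    c = form₂ w * B⁻¹
    c∈S = *-closed (rootForm-∈ W.∈S sθ₂ (+ 0)) (proj₁ (proj₂ (rootForm₂-invertible sv ν)))
    c⁻¹ = B * W.form₂⁻¹
    c⁻¹∈S = *-closed (rootForm-∈ V.∈S sθ₂ ν) W.form₂⁻¹∈S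
    cc⁻¹ : c * c⁻¹ ≈ 1#
    cc⁻¹ = trans (solve 4 (λ a b c d → (a :* b) :* (c :* d) := (a :* d) :* (c :* b)) refl _ _ _ _) (trans (*-cong W.form₂-inv BB⁻¹) (*-identityˡ 1#))
    f₂ : form₂ w ≈ c * B
    f₂ = begin
      form₂ w                 ≈⟨ trans (*-congˡ (trans (*-comm _ _) BB⁻¹)) (*-identityʳ _) ⟨
      form₂ w * (B⁻¹ * B)     ≈⟨ *-assoc _ _ _ ⟨
      c * B                   ∎
    f₁ : form₁ w ≈ c * rootForm θ₁ v ν
    f₁ = begin
      form₁ w                 ≈⟨ img ⟨
      x * form₂ w             ≈⟨ *-congˡ f₂ ⟩
      x * (c * B)             ≈⟨ solve 3 (λ x c b → x :* (c :* b) := c :* (x :* b)) refl x c B ⟩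
      c * (x * B)             ≈⟨ *-congˡ rel ⟩
      c * rootForm θ₁ v ν     ∎
    initial = initial-from-forms {w} {v} {c} {ν} f₁ f₂

  rootForm-product : ∀ {w v u} → IsProd K S P Q w v u → ∀ {α β} → α + β ≈ ι P → α * β ≈ ι Q →
                     rootForm α u (+ 0) ≈ rootForm α w (+ 0) * rootForm α v (+ 0)
  rootForm-product {w} {v} {u} (u₁ , u₀) {α} {β} α+β αβ = begin
    u (+ 1) - u (+ 0) * α
      ≈⟨ +-cong u₁ (-‿cong (*-congʳ u₀)) ⟩
    (w (+ 1) * v (+ 1) - ι Q * w (+ 0) * v (+ 0)) - (w (+ 0) * v (+ 1) + w (+ 1) * v (+ 0) - ι P * w (+ 0) * v (+ 0)) * α
      ≈⟨ +-cong (+-congˡ (-‿cong (*-congʳ (*-congʳ (sym αβ))))) (-‿cong (*-congʳ (+-congˡ (-‿cong (*-congʳ (*-congʳ (sym α+β))))))) ⟩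
    (w (+ 1) * v (+ 1) - (α * β) * w (+ 0) * v (+ 0)) - (w (+ 0) * v (+ 1) + w (+ 1) * v (+ 0) - (α + β) * w (+ 0) * v (+ 0)) * α
      ≈⟨ solve 6 (λ w1 w0 v1 v0 α β → (w1 :* v1 :- (α :* β) :* w0 :* v0) :- (w0 :* v1 :+ w1 :* v0 :- (α :+ β) :* w0 :* v0) :* α := (w1 :- w0 :* α) :* (v1 :- v0 :* α)) refl (w (+ 1)) (w (+ 0)) (v (+ 1)) (v (+ 0)) α β ⟩
    rootForm α w (+ 0) * rootForm α v (+ 0)
      ∎

  module Isomorphism (T : Carrier → Set)
    (image-∈T : ∀ w₀ w₁ a⁻¹ b⁻¹ → S w₀ → S w₁ → S a⁻¹ → S b⁻¹ →
                (w₁ - w₀ * θ₁) * a⁻¹ ≈ 1# → (w₁ - w₀ * θ₂) * b⁻¹ ≈ 1# → T ((w₁ - w₀ * θ₁) * b⁻¹))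
    (T-realisable : ∀ t → T t → Unit K S t × S ((1# - t) * d⁻¹)) where

    image : ∀ w → IsSeq K S P Q w → Σ Carrier (λ x → Related w x (+ 0) × T x)
    image w sq = form₁ w * form₂⁻¹ ,
      trans (*-assoc _ _ _) (trans (*-congˡ (trans (*-comm _ _) form₂-inv)) (*-identityʳ _)) ,
      image-∈T (w (+ 0)) (w (+ 1)) form₁⁻¹ form₂⁻¹ (∈S (+ 0)) (∈S (+ 1)) form₁⁻¹∈S form₂⁻¹∈S form₁-inv form₂-inv
      where open Solution (toSolution sq)

    ∼*⇔coset : ∀ w v x y → IsSeq K S P Q w → IsSeq K S P Q v → Related w x (+ 0) → Related v y (+ 0) →
               Sim K S P Q w v ⇔ QRel K (InCyc K r) x y
    ∼*⇔coset w v x y sw sv imgw imgv = mk⇔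
      (λ w∼v → let (ν , rel) = ∼*⇒related imgw w∼v in related⇒coset (toSolution sv) imgv ν rel)
      (λ coset → let (ν , rel) = coset⇒related (proj₁ (proj₂ sv)) imgv coset in related⇒∼* (toSolution sw) (toSolution sv) imgw ν rel)

    image-* : ∀ w v u x y z → IsSeq K S P Q w → IsSeq K S P Q v → IsSeq K S P Q u → IsProd K S P Q w v u →
              Related w x (+ 0) → Related v y (+ 0) → Related u z (+ 0) → QRel K (InCyc K r) z (x * y)
    image-* w v u x y z _ _ su prod imgw imgv imgu = 1# , (0 , inj₁ refl) , trans z≈xy (sym (*-identityˡ _))
      where
      z≈xy : z ≈ x * y
      z≈xy = *-cancelʳ-unit (begin
        z * form₂ u                    ≈⟨ imgu ⟩
        form₁ u                        ≈⟨ rootForm-product {w} {v} {u} prod θ₁+θ₂ θ₁θ₂ ⟩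
        form₁ w * form₁ v              ≈⟨ *-cong imgw imgv ⟨
        (x * form₂ w) * (y * form₂ v)  ≈⟨ solve 4 (λ x a y b → (x :* a) :* (y :* b) := (x :* y) :* (a :* b)) refl x _ y _ ⟩
        (x * y) * (form₂ w * form₂ v)  ≈⟨ *-congˡ (rootForm-product {w} {v} {u} prod θ₂+θ₁ θ₂θ₁) ⟨
        (x * y) * form₂ u              ∎) (Solution.form₂-inv (toSolution su))

    -- The preimage of t has initial values w₀ = (1 - t)/(θ₁ - θ₂) and w₁ = 1 + w₀ θ₂, so that its forms are t and 1.
    image-surjective : ∀ t → T t → Σ (ℤ → Carrier) (λ w → Σ Carrier (λ x → IsSeq K S P Q w × Related w x (+ 0) × QRel K (InCyc K r) x t))
    image-surjective t t∈T =
      M.solution , t , (M.solution-∈ sr sP sQ sQ⁻¹ w₀∈S w₁∈S , M.solution-recurrence , norm-unit) , img ,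
      (1# , (0 , inj₁ refl) , sym (*-identityˡ t))
      where
      t-unit = proj₁ (T-realisable t t∈T)
      w₀ = (1# - t) * d⁻¹
      w₀∈S : S w₀
      w₀∈S = proj₂ (T-realisable t t∈T)
      w₁ = 1# + w₀ * θ₂
      w₁∈S : S w₁
      w₁∈S = +-closed 1-closed (*-closed w₀∈S sθ₂)
      module M = InitialValues (ι P) (ι Q) Q⁻¹ QQ⁻¹ w₀ w₁
      f₂ : w₁ - w₀ * θ₂ ≈ 1#
      f₂ = solve 2 (λ a b → (con (+ 1) :+ a :* b) :- a :* b := con (+ 1)) refl w₀ θ₂
      f₁ : w₁ - w₀ * θ₁ ≈ t
      f₁ = begin
        w₁ - w₀ * θ₁                        ≈⟨ solve 5 (λ t i t1 t2 o → (o :+ ((o :- t) :* i) :* t2) :- ((o :- t) :* i) :* t1 := o :- (o :- t) :* ((t1 :- t2) :* i)) refl t d⁻¹ θ₁ θ₂ 1# ⟩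
        1# - (1# - t) * ((θ₁ - θ₂) * d⁻¹)   ≈⟨ +-congˡ (-‿cong (*-congˡ dd⁻¹)) ⟩
        1# - (1# - t) * 1#                  ≈⟨ solve 1 (λ t → con (+ 1) :- (con (+ 1) :- t) :* con (+ 1) := t) refl t ⟩
        t                                   ∎
      img : Related M.solution t (+ 0)
      img = trans (*-congˡ f₂) (trans (*-identityʳ t) (sym f₁))
      norm≈t = trans (norm≈form₁*form₂ M.solution) (trans (*-cong f₁ f₂) (*-identityʳ t))
      norm-unit = ∈-resp-≈ (sym norm≈t) (proj₁ t-unit) , proj₁ (proj₂ t-unit) , proj₁ (proj₂ (proj₂ t-unit)) ,
                  trans (*-congʳ norm≈t) (proj₂ (proj₂ (proj₂ t-unit)))

    theorem : RedIso K S P Q θ₁ θ₂ r T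
    theorem = image , ∼*⇔coset , image-* , image-surjective

  units-image-∈ : ∀ w₀ w₁ a⁻¹ b⁻¹ → S w₀ → S w₁ → S a⁻¹ → S b⁻¹ → (w₁ - w₀ * θ₁) * a⁻¹ ≈ 1# → (w₁ - w₀ * θ₂) * b⁻¹ ≈ 1# →
                  Unit K S ((w₁ - w₀ * θ₁) * b⁻¹)
  units-image-∈ w₀ w₁ a⁻¹ b⁻¹ sw₀ sw₁ sa⁻¹ sb⁻¹ aa⁻¹ bb⁻¹ =
    *-closed (+-closed sw₁ (-‿closed (*-closed sw₀ sθ₁))) sb⁻¹ , (w₁ - w₀ * θ₂) * a⁻¹ ,
    *-closed (+-closed sw₁ (-‿closed (*-closed sw₀ sθ₂))) sa⁻¹ ,
    trans (solve 4 (λ a bi b ai → (a :* bi) :* (b :* ai) := (a :* ai) :* (b :* bi)) refl _ _ _ _) (trans (*-cong aa⁻¹ bb⁻¹) (*-identityˡ 1#))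

  units-realisable : S d⁻¹ → ∀ t → Unit K S t → Unit K S t × S ((1# - t) * d⁻¹)
  units-realisable sd⁻¹ t ut = ut , *-closed (+-closed 1-closed (-‿closed (proj₁ ut))) sd⁻¹

-- Elements of K[θ] are pairs (a , b) = a + bθ; the conjugate root is θ̄ = P - θ and θ⁻¹ = Q⁻¹ θ̄.
module IrreducibleCase (K : Rng) (isCR : IsCommutativeRng K) (S : Rng.Carrier K → Set) (sr : CRing.Subring K isCR S)
  (P Q : ℤ) (sP : S (Rng.ι K P)) (uQ : Unit K S (Rng.ι K Q))
  where
  module B = CRing K isCR
  module E = CRing (Ext K P Q) (Ext-isCommutativeRng K isCR P Q)
  open B using (Carrier; ι; 0#; 1#; Recurrence; solve; _:+_; _:*_; :-_; _:-_; _:=_; con)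
  open B.Subring sr

  private
    p q Q⁻¹ : Carrier
    p = ι P
    q = ι Q
    Q⁻¹ = proj₁ (proj₂ uQ)
    sQ = proj₁ uQ
    sQ⁻¹ = proj₁ (proj₂ (proj₂ uQ))
    qQ⁻¹ = proj₂ (proj₂ (proj₂ uQ))

  emb : Carrier → E.Carrier
  emb c = c , 0#

  θ θ̄ θ⁻¹ : E.Carrier
  θ = 0# , 1#
  θ̄ = p , B.- 1#
  θ⁻¹ = emb Q⁻¹ E.* θ̄

  emb-*ˡ : ∀ c x → (emb c E.* x) E.≈ (c B.* proj₁ x , c B.* proj₂ x)
  emb-*ˡ c x = solve 5 (λ c a b p q → c :* a :- q :* (con (+ 0) :* b) := c :* a) B.refl c (proj₁ x) (proj₂ x) p q
             , solve 5 (λ c a b p q → c :* b :+ con (+ 0) :* a :+ p :* (con (+ 0) :* b) := c :* b) B.refl c (proj₁ x) (proj₂ x) p q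

  emb-* : ∀ a b → (emb a E.* emb b) E.≈ emb (a B.* b)
  emb-* a b = E.trans (emb-*ˡ a (emb b)) (B.refl , B.zeroʳ a)

  emb-cong : ∀ {a b} → a B.≈ b → emb a E.≈ emb b
  emb-cong e = e , B.refl

  emb-^ : ∀ a k → (emb a E.^ k) E.≈ emb (a B.^ k)
  emb-^ a zero    = E.refl
  emb-^ a (suc k) = E.trans (E.*-congˡ (emb-^ a k)) (emb-* a (a B.^ k))

  θ+θ̄ : (θ E.+ θ̄) E.≈ E.ι P
  θ+θ̄ = B.+-identityˡ p , B.-‿inverseʳ 1#

  θθ̄ : (θ E.* θ̄) E.≈ E.ι Q
  θθ̄ = solve 2 (λ p q → con (+ 0) :* p :- q :* (con (+ 1) :* (:- con (+ 1))) := q) B.refl p q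
     , solve 1 (λ p → con (+ 0) :* (:- con (+ 1)) :+ con (+ 1) :* p :+ p :* (con (+ 1) :* (:- con (+ 1))) := con (+ 0)) B.refl p

  θθ⁻¹ : (θ E.* θ⁻¹) E.≈ E.1#
  θθ⁻¹ = E.begin
    θ E.* (emb Q⁻¹ E.* θ̄)   E.≈⟨ E.solve 3 (λ a b c → a E.:* (b E.:* c) E.:= b E.:* (a E.:* c)) E.refl θ (emb Q⁻¹) θ̄ ⟩
    emb Q⁻¹ E.* (θ E.* θ̄)   E.≈⟨ E.*-congˡ θθ̄ ⟩
    emb Q⁻¹ E.* emb q       E.≈⟨ emb-* Q⁻¹ q ⟩
    emb (Q⁻¹ B.* q)         E.≈⟨ emb-cong (B.trans (B.*-comm _ _) qQ⁻¹) ⟩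
    E.1#                    E.∎

  θ̄^ : ∀ k → (θ̄ E.^ k) E.≈ (emb (q B.^ k) E.* (θ⁻¹ E.^ k))
  θ̄^ k = E.begin
    θ̄ E.^ k                         E.≈⟨ E.^-cong k θ̄≈qθ⁻¹ ⟩
    (emb q E.* θ⁻¹) E.^ k           E.≈⟨ E.^-distrib-* (emb q) θ⁻¹ k ⟨
    (emb q E.^ k) E.* (θ⁻¹ E.^ k)   E.≈⟨ E.*-congʳ (emb-^ q k) ⟩
    emb (q B.^ k) E.* (θ⁻¹ E.^ k)   E.∎
    where
    θ̄≈qθ⁻¹ : θ̄ E.≈ (emb q E.* θ⁻¹)
    θ̄≈qθ⁻¹ = E.begin
      θ̄                             E.≈⟨ E.*-identityˡ θ̄ ⟨
      emb 1# E.* θ̄                  E.≈⟨ E.*-congʳ (emb-cong (B.sym qQ⁻¹)) ⟩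
      emb (q B.* Q⁻¹) E.* θ̄         E.≈⟨ E.*-congʳ (emb-* q Q⁻¹) ⟨
      (emb q E.* emb Q⁻¹) E.* θ̄     E.≈⟨ E.*-assoc _ _ _ ⟩
      emb q E.* θ⁻¹                 E.∎

  θ⁻¹^ : ∀ k → (θ⁻¹ E.^ k) E.≈ (emb (Q⁻¹ B.^ k) E.* (θ̄ E.^ k))
  θ⁻¹^ k = E.trans (E.sym (E.^-distrib-* (emb Q⁻¹) θ̄ k)) (E.*-congʳ (emb-^ Q⁻¹ k))

  θ^θ̄^ : ∀ k → ((θ E.^ k) E.* (θ̄ E.^ k)) E.≈ emb (q B.^ k)
  θ^θ̄^ k = E.trans (E.^-distrib-* θ θ̄ k) (E.trans (E.^-cong k θθ̄) (emb-^ q k))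

  lift : (ℤ → Carrier) → ℤ → E.Carrier
  lift v n = emb (v n)

  -- v (n+1) - v n θ, the image of the shifted sequence k ↦ v (k + n)
  liftForm : (ℤ → Carrier) → ℤ → E.Carrier
  liftForm v n = v (n ℤ.+ + 1) , B.- v n

  module Lifted {v : ℤ → Carrier} (rv : Recurrence p q v) where
    lift-recurrence : E.Recurrence (E.ι P) (E.ι Q) (lift v)
    lift-recurrence n =
        B.trans (rv n) (solve 4 (λ p q a b → p :* a :- q :* b := (p :* a :- q :* (con (+ 0) :* con (+ 0))) :- (q :* b :- q :* (con (+ 0) :* con (+ 0)))) B.refl p q _ _)
      , solve 4 (λ p q a b → con (+ 0) := (p :* con (+ 0) :+ con (+ 0) :* a :+ p :* (con (+ 0) :* con (+ 0))) :- (q :* con (+ 0) :+ con (+ 0) :* b :+ p :* (con (+ 0) :* con (+ 0)))) B.refl p q (v (n ℤ.+ + 1)) (v n)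

    open E.RootForm θ+θ̄ θθ̄ lift-recurrence

    rootForm≈liftForm : ∀ n → E.rootForm θ (lift v) n E.≈ liftForm v n
    rootForm≈liftForm n =
        solve 4 (λ a b p q → a :+ :- (b :* con (+ 0) :- q :* (con (+ 0) :* con (+ 1))) := a) B.refl (v (n ℤ.+ + 1)) (v n) p q
      , solve 4 (λ a b p q → con (+ 0) :+ :- (b :* con (+ 1) :+ con (+ 0) :* con (+ 0) :+ p :* (con (+ 0) :* con (+ 1))) := :- b) B.refl (v (n ℤ.+ + 1)) (v n) p q

    liftForm-shift : ∀ n k → liftForm v (n ℤ.+ + k) E.≈ ((θ̄ E.^ k) E.* liftForm v n)
    liftForm-shift n k = E.trans (E.sym (rootForm≈liftForm (n ℤ.+ + k))) (E.trans (rootForm-shift n k) (E.*-congˡ (rootForm≈liftForm n)))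

  S[θ] : E.Carrier → Set
  S[θ] x = S (proj₁ x) × S (proj₂ x)

  S×⟨θ⟩ : E.Carrier → Set
  S×⟨θ⟩ y = Σ Carrier (λ c → Σ E.Carrier (λ z → Unit K S c × InCyc (Ext K P Q) θ z × (y E.≈ (emb c E.* z))))

  Image : (ℤ → Carrier) → E.Carrier → Set
  Image w x = x E.≈ liftForm w (+ 0)

  unit-* : ∀ {c d d⁻¹} → Unit K S c → S d → S d⁻¹ → d B.* d⁻¹ B.≈ 1# → Unit K S (c B.* d)
  unit-* (sc , c⁻¹ , sc⁻¹ , cc⁻¹) sd sd⁻¹ dd⁻¹ = *-closed sc sd , c⁻¹ B.* _ , *-closed sc⁻¹ sd⁻¹ , B.inverse-* cc⁻¹ dd⁻¹

  liftForm-scaled-shift : ∀ {w v c ν} → (∀ n → w n B.≈ c B.* v (n ℤ.+ ν)) → liftForm w (+ 0) E.≈ (emb c E.* liftForm v ν)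
  liftForm-scaled-shift {w} {v} {c} {ν} w≈cv = E.sym (E.trans (emb-*ˡ c (liftForm v ν))
     (B.sym (B.trans (w≈cv (+ 1)) (B.*-congˡ (B.≈-at v (ℤP.+-comm (+ 1) ν))))
     , B.sym (B.trans (B.-‿cong (B.trans (w≈cv (+ 0)) (B.*-congˡ (B.≈-at v (ℤP.+-identityˡ ν)))))
                      (solve 2 (λ c a → :- (c :* a) := c :* (:- a)) B.refl c (v ν)))))

  ∼*⇒coset : ∀ {w v x y} → Recurrence p q v → Image w x → Image v y → Sim K S P Q w v → QRel (Ext K P Q) S×⟨θ⟩ x y
  ∼*⇒coset {w} {v} {x} {y} rv imgw imgv (c , uc , + k , w≈cv) =
    h , (c B.* (q B.^ k) , θ⁻¹ E.^ k , unit-* uc (^-closed sQ k) (^-closed sQ⁻¹ k) (B.^-inverse k qQ⁻¹) , (k , inj₂ θ⁻¹^θ^) , E.refl) , x≈hy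
    where
    open Lifted rv
    h = emb (c B.* (q B.^ k)) E.* (θ⁻¹ E.^ k)
    θ⁻¹^θ^ : ((θ⁻¹ E.^ k) E.* (θ E.^ k)) E.≈ E.1#
    θ⁻¹^θ^ = E.^-inverse k (E.trans (E.*-comm _ _) θθ⁻¹)
    x≈hy : x E.≈ (h E.* y)
    x≈hy = E.begin
      x                                                    E.≈⟨ imgw ⟩
      liftForm w (+ 0)                                     E.≈⟨ liftForm-scaled-shift {w} {v} {c} {+ k} w≈cv ⟩
      emb c E.* liftForm v (+ 0 ℤ.+ + k)                   E.≈⟨ E.*-congˡ (liftForm-shift (+ 0) k) ⟩
      emb c E.* ((θ̄ E.^ k) E.* liftForm v (+ 0))           E.≈⟨ E.*-congˡ (E.*-cong (θ̄^ k) (E.sym imgv)) ⟩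
      emb c E.* ((emb (q B.^ k) E.* (θ⁻¹ E.^ k)) E.* y)    E.≈⟨ E.solve 4 (λ a b c d → a E.:* ((b E.:* c) E.:* d) E.:= ((a E.:* b) E.:* c) E.:* d) E.refl _ _ _ y ⟩
      ((emb c E.* emb (q B.^ k)) E.* (θ⁻¹ E.^ k)) E.* y    E.≈⟨ E.*-congʳ (E.*-congʳ (emb-* c (q B.^ k))) ⟩
      h E.* y                                              E.∎
  ∼*⇒coset {w} {v} {x} {y} rv imgw imgv (c , uc , ν@(-[1+ k ]) , w≈cv) =
    h , (c B.* (Q⁻¹ B.^ m) , θ E.^ m , unit-* uc (^-closed sQ⁻¹ m) (^-closed sQ m) (B.trans (B.*-comm _ _) (B.^-inverse m qQ⁻¹)) , (m , inj₁ E.refl) , E.refl) , E.sym hy≈x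
    where
    open Lifted rv
    m = suc k
    h = emb (c B.* (Q⁻¹ B.^ m)) E.* (θ E.^ m)
    y≈ : y E.≈ ((θ̄ E.^ m) E.* liftForm v ν)
    y≈ = E.trans imgv (E.trans (E.reflexive (≡.cong (liftForm v) (≡.sym (ℤP.+-inverseˡ (+ m))))) (liftForm-shift ν m))
    cQ⁻¹^q^ : (c B.* (Q⁻¹ B.^ m)) B.* (q B.^ m) B.≈ c
    cQ⁻¹^q^ = B.trans (B.*-assoc _ _ _) (B.trans (B.*-congˡ (B.trans (B.*-comm _ _) (B.^-inverse m qQ⁻¹))) (B.*-identityʳ c))
    hy≈x : (h E.* y) E.≈ x
    hy≈x = E.begin
      h E.* y                                                             E.≈⟨ E.*-congˡ y≈ ⟩
      h E.* ((θ̄ E.^ m) E.* liftForm v ν)                                  E.≈⟨ E.solve 4 (λ a b c d → (a E.:* b) E.:* (c E.:* d) E.:= a E.:* ((b E.:* c) E.:* d)) E.refl _ _ _ _ ⟩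
      emb (c B.* (Q⁻¹ B.^ m)) E.* (((θ E.^ m) E.* (θ̄ E.^ m)) E.* liftForm v ν) E.≈⟨ E.*-congˡ (E.*-congʳ (θ^θ̄^ m)) ⟩
      emb (c B.* (Q⁻¹ B.^ m)) E.* (emb (q B.^ m) E.* liftForm v ν)        E.≈⟨ E.*-assoc _ _ _ ⟨
      (emb (c B.* (Q⁻¹ B.^ m)) E.* emb (q B.^ m)) E.* liftForm v ν        E.≈⟨ E.*-congʳ (E.trans (emb-* _ _) (emb-cong cQ⁻¹^q^)) ⟩
      emb c E.* liftForm v ν                                              E.≈⟨ liftForm-scaled-shift {w} {v} {c} {ν} w≈cv ⟨
      liftForm w (+ 0)                                                    E.≈⟨ imgw ⟨
      x                                                                   E.∎

  ∼*-from-liftForm : ∀ {w v c ν} → Recurrence p q w → Recurrence p q v → Unit K S c →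
                     liftForm w (+ 0) E.≈ (emb c E.* liftForm v ν) → Sim K S P Q w v
  ∼*-from-liftForm {w} {v} {c} {ν} rw rv uc e = B.∼*-from-initial qQ⁻¹ rw rv uc w₀ (proj₁ e′)
    where
    e′ = E.trans e (emb-*ˡ c (liftForm v ν))
    w₀ : w (+ 0) B.≈ c B.* v ν
    w₀ = B.trans (solve 1 (λ a → a := :- (:- a)) B.refl (w (+ 0)))
           (B.trans (B.-‿cong (proj₂ e′)) (solve 2 (λ c a → :- (c :* (:- a)) := c :* a) B.refl c (v ν)))

  coset⇒∼* : ∀ {w v x y} → Recurrence p q w → Recurrence p q v → Image w x → Image v y → QRel (Ext K P Q) S×⟨θ⟩ x y → Sim K S P Q w v
  coset⇒∼* {w} {v} {x} {y} rw rv imgw imgv (h , (c , z , uc , (k , inj₁ z≈θ^) , h≈cz) , x≈hy) =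
    ∼*-from-liftForm {w} {v} {c B.* (q B.^ k)} {ν} rw rv (unit-* uc (^-closed sQ k) (^-closed sQ⁻¹ k) (B.^-inverse k qQ⁻¹)) (E.begin
      liftForm w (+ 0)                                           E.≈⟨ imgw ⟨
      x                                                          E.≈⟨ x≈hy ⟩
      h E.* y                                                    E.≈⟨ E.*-cong (E.trans h≈cz (E.*-congˡ z≈θ^)) y≈ ⟩
      (emb c E.* (θ E.^ k)) E.* ((θ̄ E.^ k) E.* liftForm v ν)     E.≈⟨ E.solve 4 (λ a b c d → (a E.:* b) E.:* (c E.:* d) E.:= a E.:* ((b E.:* c) E.:* d)) E.refl _ _ _ _ ⟩
      emb c E.* (((θ E.^ k) E.* (θ̄ E.^ k)) E.* liftForm v ν)     E.≈⟨ E.*-congˡ (E.*-congʳ (θ^θ̄^ k)) ⟩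
      emb c E.* (emb (q B.^ k) E.* liftForm v ν)                 E.≈⟨ E.*-assoc _ _ _ ⟨
      (emb c E.* emb (q B.^ k)) E.* liftForm v ν                 E.≈⟨ E.*-congʳ (emb-* c _) ⟩
      emb (c B.* (q B.^ k)) E.* liftForm v ν                     E.∎)
    where
    open Lifted rv
    ν = ℤ.- (+ k)
    y≈ : y E.≈ ((θ̄ E.^ k) E.* liftForm v ν)
    y≈ = E.trans imgv (E.trans (E.reflexive (≡.cong (liftForm v) (≡.sym (ℤP.+-inverseˡ (+ k))))) (liftForm-shift ν k))
  coset⇒∼* {w} {v} {x} {y} rw rv imgw imgv (h , (c , z , uc , (k , inj₂ zθ^) , h≈cz) , x≈hy) =
    ∼*-from-liftForm {w} {v} {c B.* (Q⁻¹ B.^ k)} {+ k} rw rv (unit-* uc (^-closed sQ⁻¹ k) (^-closed sQ k) (B.trans (B.*-comm _ _) (B.^-inverse k qQ⁻¹))) (E.begin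
      liftForm w (+ 0)                                                 E.≈⟨ imgw ⟨
      x                                                                E.≈⟨ x≈hy ⟩
      h E.* y                                                          E.≈⟨ E.*-cong (E.trans h≈cz (E.*-congˡ (E.trans z≈θ⁻¹^ (θ⁻¹^ k)))) imgv ⟩
      (emb c E.* (emb (Q⁻¹ B.^ k) E.* (θ̄ E.^ k))) E.* liftForm v (+ 0)  E.≈⟨ E.solve 4 (λ a b c d → (a E.:* (b E.:* c)) E.:* d E.:= (a E.:* b) E.:* (c E.:* d)) E.refl _ _ _ _ ⟩
      (emb c E.* emb (Q⁻¹ B.^ k)) E.* ((θ̄ E.^ k) E.* liftForm v (+ 0))  E.≈⟨ E.*-cong (emb-* c _) (E.sym (liftForm-shift (+ 0) k)) ⟩
      emb (c B.* (Q⁻¹ B.^ k)) E.* liftForm v (+ k)                     E.∎)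
    where
    open Lifted rv
    z≈θ⁻¹^ : z E.≈ (θ⁻¹ E.^ k)
    z≈θ⁻¹^ = E.begin
      z                                       E.≈⟨ E.trans (E.*-congˡ (E.^-inverse k θθ⁻¹)) (E.*-identityʳ z) ⟨
      z E.* ((θ E.^ k) E.* (θ⁻¹ E.^ k))       E.≈⟨ E.*-assoc _ _ _ ⟨
      (z E.* (θ E.^ k)) E.* (θ⁻¹ E.^ k)       E.≈⟨ E.*-congʳ zθ^ ⟩
      E.1# E.* (θ⁻¹ E.^ k)                    E.≈⟨ E.*-identityˡ _ ⟩
      θ⁻¹ E.^ k                               E.∎

  private
    trivial-coset : ∀ {x y} → x E.≈ y → QRel (Ext K P Q) S×⟨θ⟩ x y
    trivial-coset {x} {y} x≈y = emb 1# E.* E.1# , (1# , E.1# , (1-closed , 1# , 1-closed , B.*-identityˡ 1#) , (0 , inj₁ E.refl) , E.refl) ,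
      E.trans x≈y (E.trans (E.sym (E.*-identityˡ y)) (E.*-congʳ (E.sym 1·1≈1)))
      where
      1·1≈1 : (emb 1# E.* E.1#) E.≈ E.1#
      1·1≈1 = E.trans (emb-*ˡ 1# E.1#) (B.*-identityˡ 1# , B.zeroʳ 1#)

  norm : E.Carrier → Carrier
  norm (a , b) = a B.* a B.+ p B.* a B.* b B.+ q B.* b B.* b

  norm-cong : ∀ {x y} → x E.≈ y → norm x B.≈ norm y
  norm-cong (a≈c , b≈d) = B.+-cong (B.+-cong (B.*-cong a≈c a≈c) (B.*-cong (B.*-congˡ a≈c) b≈d)) (B.*-cong (B.*-congˡ b≈d) b≈d)

  norm-* : ∀ x y → norm x B.* norm y B.≈ norm (x E.* y)
  norm-* (a , b) (c , d) = solve 6 (λ a b c d p q → (a :* a :+ p :* a :* b :+ q :* b :* b) :* (c :* c :+ p :* c :* d :+ q :* d :* d)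
      := (a :* c :- q :* (b :* d)) :* (a :* c :- q :* (b :* d)) :+ p :* (a :* c :- q :* (b :* d)) :* (a :* d :+ b :* c :+ p :* (b :* d))
         :+ q :* (a :* d :+ b :* c :+ p :* (b :* d)) :* (a :* d :+ b :* c :+ p :* (b :* d))) B.refl a b c d p q

  image : ∀ w → IsSeq K S P Q w → Σ E.Carrier (λ x → Image w x × Unit (Ext K P Q) S[θ] x)
  image w (sw , _ , (_ , m , sm , nm≈1)) =
    liftForm w (+ 0) , E.refl , (sw (+ 1) , -‿closed (sw (+ 0))) , x⁻¹ ,
    (*-closed (+-closed (sw (+ 1)) (-‿closed (*-closed sP (sw (+ 0))))) sm , *-closed (sw (+ 0)) sm) , xx⁻¹
    where
    w₁ = w (+ 1)
    w₀ = w (+ 0)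
    x⁻¹ = (w₁ B.- p B.* w₀) B.* m , w₀ B.* m
    xx⁻¹ : (liftForm w (+ 0) E.* x⁻¹) E.≈ E.1#
    xx⁻¹ = B.trans (solve 5 (λ w1 w0 m p q → w1 :* ((w1 :- p :* w0) :* m) :- q :* ((:- w0) :* (w0 :* m)) := (w1 :* w1 :- p :* w0 :* w1 :+ q :* w0 :* w0) :* m) B.refl w₁ w₀ m p q) nm≈1
         , solve 5 (λ w1 w0 m p q → w1 :* (w0 :* m) :+ (:- w0) :* ((w1 :- p :* w0) :* m) :+ p :* ((:- w0) :* (w0 :* m)) := con (+ 0)) B.refl w₁ w₀ m p q

  image-* : ∀ w v u x y z → IsProd K S P Q w v u → Image w x → Image v y → Image u z → QRel (Ext K P Q) S×⟨θ⟩ z (x E.* y)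
  image-* w v u x y z (u₁ , u₀) imgw imgv imgu = trivial-coset (E.trans imgu (E.trans liftForm-* (E.sym (E.*-cong imgw imgv))))
    where
    liftForm-* : liftForm u (+ 0) E.≈ (liftForm w (+ 0) E.* liftForm v (+ 0))
    liftForm-* = B.trans u₁ (solve 5 (λ w1 w0 v1 v0 q → w1 :* v1 :- q :* w0 :* v0 := w1 :* v1 :- q :* ((:- w0) :* (:- v0))) B.refl (w (+ 1)) (w (+ 0)) (v (+ 1)) (v (+ 0)) q)
              , B.trans (B.-‿cong u₀) (solve 5 (λ w1 w0 v1 v0 p → :- (w0 :* v1 :+ w1 :* v0 :- p :* w0 :* v0) := w1 :* (:- v0) :+ (:- w0) :* v1 :+ p :* ((:- w0) :* (:- v0))) B.refl (w (+ 1)) (w (+ 0)) (v (+ 1)) (v (+ 0)) p)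

  image-surjective : ∀ t → Unit (Ext K P Q) S[θ] t → Σ (ℤ → Carrier) (λ w → Σ E.Carrier (λ x → IsSeq K S P Q w × Image w x × QRel (Ext K P Q) S×⟨θ⟩ x t))
  image-surjective t ((st₁ , st₂) , s , (ss₁ , ss₂) , ts≈1) =
    M.solution , liftForm M.solution (+ 0) , (M.solution-∈ sr sP sQ sQ⁻¹ (-‿closed st₂) st₁ , M.solution-recurrence , norm-unit) , E.refl ,
    trivial-coset (B.refl , solve 1 (λ a → :- (:- a) := a) B.refl (proj₂ t))
    where
    module M = B.InitialValues p q Q⁻¹ qQ⁻¹ (B.- proj₂ t) (proj₁ t)
    norm-t·norm-s : norm t B.* norm s B.≈ 1#
    norm-t·norm-s = B.trans (norm-* t s) (B.trans (norm-cong ts≈1)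
      (solve 2 (λ p q → con (+ 1) :* con (+ 1) :+ p :* con (+ 1) :* con (+ 0) :+ q :* con (+ 0) :* con (+ 0) := con (+ 1)) B.refl p q))
    norm≈ : M.solution (+ 1) B.* M.solution (+ 1) B.- p B.* M.solution (+ 0) B.* M.solution (+ 1) B.+ q B.* M.solution (+ 0) B.* M.solution (+ 0) B.≈ norm t
    norm≈ = solve 4 (λ a b p q → a :* a :- p :* (:- b) :* a :+ q :* (:- b) :* (:- b) := a :* a :+ p :* a :* b :+ q :* b :* b) B.refl (proj₁ t) (proj₂ t) p q
    norm-unit = ∈-resp-≈ (B.sym norm≈) (+-closed (+-closed (*-closed st₁ st₁) (*-closed (*-closed sP st₁) st₂)) (*-closed (*-closed sQ st₂) st₂)) ,
                norm s , +-closed (+-closed (*-closed ss₁ ss₁) (*-closed (*-closed sP ss₁) ss₂)) (*-closed (*-closed sQ ss₂) ss₂) ,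
                B.trans (B.*-congʳ norm≈) norm-t·norm-s

  theorem : IrrIso K S P Q
  theorem = image
          , (λ w v x y (_ , rw , _) (_ , rv , _) imgw imgv → mk⇔ (∼*⇒coset rv imgw imgv) (coset⇒∼* rw rv imgw imgv))
          , (λ w v u x y z _ _ _ → image-* w v u x y z)
          , image-surjective

-- A double root θ makes every solution of the form θⁿ (a + n b); when every element of K is an integer
-- multiple of 1 the parameter n can be matched, so all solutions are equivalent.
module RepeatedRoot (K : Rng) (isCR : IsCommutativeRng K) (P Q : ℤ) (θ : Rng.Carrier K)
  (θ+θ : Rng._≈_ K (Rng._+_ K θ θ) (Rng.ι K P)) (θθ : Rng._≈_ K (Rng._*_ K θ θ) (Rng.ι K Q))
  (Q⁻¹ : Rng.Carrier K) (QQ⁻¹ : Rng._≈_ K (Rng._*_ K (Rng.ι K Q) Q⁻¹) (Rng.1# K))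
  (prime-field : ∀ x → Σ ℕ (λ k → Rng._≈_ K (CRing.fromℤ K isCR (+ k)) x))
  where
  open CRing K isCR

  private
    module R {v} (rv : Recurrence (ι P) (ι Q) v) = RootForm θ+θ θθ rv

    θ⁻¹ = θ * Q⁻¹
    θθ⁻¹ : θ * θ⁻¹ ≈ 1#
    θθ⁻¹ = trans (sym (*-assoc θ θ Q⁻¹)) (trans (*-congʳ θθ) QQ⁻¹)

  norm≈rootForm² : ∀ w → w (+ 1) * w (+ 1) - ι P * w (+ 0) * w (+ 1) + ι Q * w (+ 0) * w (+ 0) ≈ rootForm θ w (+ 0) * rootForm θ w (+ 0)
  norm≈rootForm² w = begin
    w (+ 1) * w (+ 1) - ι P * w (+ 0) * w (+ 1) + ι Q * w (+ 0) * w (+ 0)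
      ≈⟨ +-cong (+-congˡ (-‿cong (*-congʳ (*-congʳ (sym θ+θ))))) (*-congʳ (*-congʳ (sym θθ))) ⟩
    w (+ 1) * w (+ 1) - (θ + θ) * w (+ 0) * w (+ 1) + (θ * θ) * w (+ 0) * w (+ 0)
      ≈⟨ solve 3 (λ x y t → x :* x :- (t :+ t) :* y :* x :+ (t :* t) :* y :* y := (x :- y :* t) :* (x :- y :* t)) refl (w (+ 1)) (w (+ 0)) θ ⟩
    rootForm θ w (+ 0) * rootForm θ w (+ 0)
      ∎

  closed-form : ∀ {v} → Recurrence (ι P) (ι Q) v → ∀ k → θ * v (+ k) ≈ (θ ^ k) * (θ * v (+ 0) + fromℤ (+ k) * rootForm θ v (+ 0))
  closed-form {v} rv zero = begin
    θ * v (+ 0)                                           ≈⟨ trans (+-congˡ (zeroˡ B)) (+-identityʳ _) ⟨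
    θ * v (+ 0) + 0# * B                                  ≈⟨ *-identityˡ _ ⟨
    1# * (θ * v (+ 0) + 0# * B)                           ∎
    where B = rootForm θ v (+ 0)
  closed-form {v} rv (suc k) = begin
    θ * v (+ suc k)                                       ≈⟨ *-congˡ step ⟩
    θ * (θ * v (+ k) + (θ ^ k) * B)                       ≈⟨ solve 4 (λ t x tk b → t :* (x :+ tk :* b) := t :* x :+ (t :* tk) :* b) refl θ (θ * v (+ k)) (θ ^ k) B ⟩
    θ * (θ * v (+ k)) + (θ * (θ ^ k)) * B                 ≈⟨ +-congʳ (*-congˡ (closed-form rv k)) ⟩
    θ * ((θ ^ k) * (θ * v (+ 0) + n * B)) + (θ * (θ ^ k)) * B ≈⟨ solve 5 (λ t tk x n b → t :* (tk :* (x :+ n :* b)) :+ (t :* tk) :* b := (t :* tk) :* (x :+ (con (+ 1) :+ n) :* b)) refl θ (θ ^ k) (θ * v (+ 0)) n B ⟩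
    (θ * (θ ^ k)) * (θ * v (+ 0) + (1# + n) * B)          ≈⟨ *-congˡ (+-congˡ (*-congʳ (fromℤ-+ (+ 1) (+ k)))) ⟨
    (θ * (θ ^ k)) * (θ * v (+ 0) + fromℤ (+ suc k) * B)   ∎
    where
    B = rootForm θ v (+ 0)
    n = fromℤ (+ k)
    step : v (+ suc k) ≈ θ * v (+ k) + (θ ^ k) * B
    step = begin
      v (+ suc k)                       ≈⟨ ≈-at v (+1-pos k) ⟨
      v (+ k ℤ.+ + 1)                   ≈⟨ solve 3 (λ a b t → a := (a :- b :* t) :+ t :* b) refl (v (+ k ℤ.+ + 1)) (v (+ k)) θ ⟩
      rootForm θ v (+ k) + θ * v (+ k)  ≈⟨ +-congʳ (R.rootForm-shift rv (+ 0) k) ⟩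
      (θ ^ k) * B + θ * v (+ k)         ≈⟨ +-comm _ _ ⟩
      θ * v (+ k) + (θ ^ k) * B         ∎

  trivial : Trivial K (λ _ → ⊤) P Q
  trivial w v (_ , rw , (_ , mw , _ , nw·mw≈1)) (_ , rv , (_ , mv , _ , nv·mv≈1)) =
    ∼*-from-initial QQ⁻¹ rw rv (tt , c⁻¹ , tt , cc⁻¹) w₀≈ w₁≈
    where
    A = rootForm θ w (+ 0)
    A⁻¹ = A * mw
    AA⁻¹ : A * A⁻¹ ≈ 1#
    AA⁻¹ = trans (sym (*-assoc _ _ _)) (trans (*-congʳ (sym (norm≈rootForm² w))) nw·mw≈1)
    B = rootForm θ v (+ 0)
    B⁻¹ = B * mv
    BB⁻¹ : B * B⁻¹ ≈ 1#
    BB⁻¹ = trans (sym (*-assoc _ _ _)) (trans (*-congʳ (sym (norm≈rootForm² v))) nv·mv≈1)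
    w₀ = w (+ 0)
    v₀ = v (+ 0)
    -- the shift k solves θ w₀ = A B⁻¹ θ v₀ + k A, by the closed form of θ v(k)
    κ = (θ * w₀ - A * B⁻¹ * θ * v₀) * A⁻¹
    k = proj₁ (prime-field κ)
    kA≈ : fromℤ (+ k) * A ≈ θ * w₀ - A * B⁻¹ * θ * v₀
    kA≈ = trans (*-congʳ (proj₂ (prime-field κ))) (trans (*-assoc _ _ _) (trans (*-congˡ (trans (*-comm _ _) AA⁻¹)) (*-identityʳ _)))
    c = A * B⁻¹ * (θ⁻¹ ^ k)
    c⁻¹ = B * A⁻¹ * (θ ^ k)
    cc⁻¹ : c * c⁻¹ ≈ 1#
    cc⁻¹ = trans (solve 6 (λ a ai b bi t ti → a :* bi :* ti :* (b :* ai :* t) := (a :* ai) :* (b :* bi) :* (t :* ti)) refl A A⁻¹ B B⁻¹ (θ ^ k) (θ⁻¹ ^ k))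
                 (trans (*-cong (*-cong AA⁻¹ BB⁻¹) (^-inverse k θθ⁻¹)) (trans (*-identityʳ _) (*-identityˡ 1#)))
    θw₀≈ : θ * w₀ ≈ c * (θ * v (+ k))
    θw₀≈ = sym (begin
      c * (θ * v (+ k))                                             ≈⟨ *-congˡ (closed-form rv k) ⟩
      (A * B⁻¹ * (θ⁻¹ ^ k)) * ((θ ^ k) * (θ * v₀ + fromℤ (+ k) * B)) ≈⟨ solve 7 (λ a bi ti t x n b → (a :* bi :* ti) :* (t :* (x :+ n :* b)) := (t :* ti) :* (a :* bi :* x :+ n :* a :* (b :* bi))) refl A B⁻¹ (θ⁻¹ ^ k) (θ ^ k) (θ * v₀) (fromℤ (+ k)) B ⟩
      ((θ ^ k) * (θ⁻¹ ^ k)) * (A * B⁻¹ * (θ * v₀) + fromℤ (+ k) * A * (B * B⁻¹)) ≈⟨ *-cong (^-inverse k θθ⁻¹) (+-congˡ (*-cong kA≈ BB⁻¹)) ⟩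
      1# * (A * B⁻¹ * (θ * v₀) + (θ * w₀ - A * B⁻¹ * θ * v₀) * 1#) ≈⟨ solve 5 (λ a bi t v0 w0 → con (+ 1) :* (a :* bi :* (t :* v0) :+ (t :* w0 :- a :* bi :* t :* v0) :* con (+ 1)) := t :* w0) refl A B⁻¹ θ v₀ w₀ ⟩
      θ * w₀                                                        ∎)
    w₀≈ : w₀ ≈ c * v (+ k)
    w₀≈ = *-cancelˡ-unit (trans θw₀≈ (solve 3 (λ c t x → c :* (t :* x) := t :* (c :* x)) refl c θ (v (+ k)))) θθ⁻¹
    A≈ : A ≈ c * rootForm θ v (+ k)
    A≈ = sym (begin
      c * rootForm θ v (+ k)                        ≈⟨ *-congˡ (R.rootForm-shift rv (+ 0) k) ⟩
      (A * B⁻¹ * (θ⁻¹ ^ k)) * ((θ ^ k) * B)         ≈⟨ solve 5 (λ a bi ti t b → (a :* bi :* ti) :* (t :* b) := a :* ((t :* ti) :* (b :* bi))) refl A B⁻¹ (θ⁻¹ ^ k) (θ ^ k) B ⟩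
      A * (((θ ^ k) * (θ⁻¹ ^ k)) * (B * B⁻¹))       ≈⟨ *-congˡ (*-cong (^-inverse k θθ⁻¹) BB⁻¹) ⟩
      A * (1# * 1#)                                 ≈⟨ trans (*-congˡ (*-identityˡ 1#)) (*-identityʳ A) ⟩
      A                                             ∎)
    w₁≈ : w (+ 1) ≈ c * v (+ k ℤ.+ + 1)
    w₁≈ = begin
      w (+ 1)                                       ≈⟨ solve 3 (λ w1 w0 t → w1 := (w1 :- w0 :* t) :+ w0 :* t) refl (w (+ 1)) w₀ θ ⟩
      A + w₀ * θ                                    ≈⟨ +-cong A≈ (*-congʳ w₀≈) ⟩
      c * rootForm θ v (+ k) + (c * v (+ k)) * θ    ≈⟨ solve 4 (λ c a b t → c :* (a :- b :* t) :+ (c :* b) :* t := c :* a) refl c (v (+ k ℤ.+ + 1)) (v (+ k)) θ ⟩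
      c * v (+ k ℤ.+ + 1)                           ∎

module _ (p : ℕ) where
  private
    open Rng (FpR p) using (_≈_)

    toSigned : ∀ {x y} → x ≈ y → (+ p) ℤS.∣ (x ℤ.- y)
    toSigned = ℤS.∣ᵤ⇒∣

  ≈-via : ∀ {x y z} → x ℤ.- y ≡ z → (+ p) ℤS.∣ z → x ≈ y
  ≈-via {x} {y} e d = ℤS.∣⇒∣ᵤ {+ p} {x ℤ.- y} (≡.subst ((+ p) ℤS.∣_) (≡.sym e) d)

  private
    ≡⇒≈ : ∀ {x y} → x ≡ y → x ≈ y
    ≡⇒≈ {x} ≡.refl = ≈-via {x} {x} (ℤP.+-inverseʳ x) (ℤS.∣n⇒∣m*n (+ 0) {+ p} ℤS.∣-refl)

    ≈-sym : ∀ {x y} → x ≈ y → y ≈ x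
    ≈-sym {x} {y} e = ≈-via {y} {x} (lemma x y) (ℤS.∣m⇒∣-m (toSigned {x} {y} e))
      where
      lemma : ∀ x y → y ℤ.- x ≡ ℤ.- (x ℤ.- y)
      lemma = solve-∀

    ≈-trans : ∀ {x y z} → x ≈ y → y ≈ z → x ≈ z
    ≈-trans {x} {y} {z} e f = ≈-via {x} {z} (lemma x y z) (ℤS.∣m∣n⇒∣m+n (toSigned {x} {y} e) (toSigned {y} {z} f))
      where
      lemma : ∀ x y z → x ℤ.- z ≡ (x ℤ.- y) ℤ.+ (y ℤ.- z)
      lemma = solve-∀

    +-cong : ∀ {x y u v} → x ≈ y → u ≈ v → (x ℤ.+ u) ≈ (y ℤ.+ v)
    +-cong {x} {y} {u} {v} e f = ≈-via {x ℤ.+ u} {y ℤ.+ v} (lemma x y u v) (ℤS.∣m∣n⇒∣m+n (toSigned {x} {y} e) (toSigned {u} {v} f))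
      where
      lemma : ∀ x y u v → (x ℤ.+ u) ℤ.- (y ℤ.+ v) ≡ (x ℤ.- y) ℤ.+ (u ℤ.- v)
      lemma = solve-∀

    *-cong : ∀ {x y u v} → x ≈ y → u ≈ v → (x ℤ.* u) ≈ (y ℤ.* v)
    *-cong {x} {y} {u} {v} e f = ≈-via {x ℤ.* u} {y ℤ.* v} (lemma x y u v) (ℤS.∣m∣n⇒∣m+n (ℤS.∣n⇒∣m*n x (toSigned {u} {v} f)) (ℤS.∣m⇒∣m*n v (toSigned {x} {y} e)))
      where
      lemma : ∀ x y u v → (x ℤ.* u) ℤ.- (y ℤ.* v) ≡ x ℤ.* (u ℤ.- v) ℤ.+ (x ℤ.- y) ℤ.* v
      lemma = solve-∀

    -‿cong : ∀ {x y} → x ≈ y → ℤ.- x ≈ ℤ.- y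
    -‿cong {x} {y} e = ≈-via {ℤ.- x} {ℤ.- y} (lemma x y) (ℤS.∣m⇒∣-m (toSigned {x} {y} e))
      where
      lemma : ∀ x y → ℤ.- x ℤ.- ℤ.- y ≡ ℤ.- (x ℤ.- y)
      lemma = solve-∀

  FpR-isCommutativeRng : IsCommutativeRng (FpR p)
  FpR-isCommutativeRng = record
    { isRing = record
      { +-isAbelianGroup = record
        { isGroup = record
          { isMonoid = record
            { isSemigroup = record
              { isMagma = record
                { isEquivalence = record { refl = λ {x} → ≡⇒≈ {x} ≡.refl ; sym = λ {x} {y} → ≈-sym {x} {y} ; trans = λ {x} {y} {z} → ≈-trans {x} {y} {z} }
                ; ∙-cong = λ {x} {y} {u} {v} → +-cong {x} {y} {u} {v} }
              ; assoc = λ x y z → ≡⇒≈ (ℤP.+-assoc x y z) }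
            ; identity = (λ x → ≡⇒≈ (ℤP.+-identityˡ x)) , (λ x → ≡⇒≈ (ℤP.+-identityʳ x)) }
          ; inverse = (λ x → ≡⇒≈ (ℤP.+-inverseˡ x)) , (λ x → ≡⇒≈ (ℤP.+-inverseʳ x))
          ; ⁻¹-cong = λ {x} {y} → -‿cong {x} {y} }
        ; comm = λ x y → ≡⇒≈ (ℤP.+-comm x y) }
      ; *-cong = λ {x} {y} {u} {v} → *-cong {x} {y} {u} {v}
      ; *-assoc = λ x y z → ≡⇒≈ (ℤP.*-assoc x y z)
      ; *-identity = (λ x → ≡⇒≈ (ℤP.*-identityˡ x)) , (λ x → ≡⇒≈ (ℤP.*-identityʳ x))
      ; distrib = (λ x y z → ≡⇒≈ (ℤP.*-distribˡ-+ x y z)) , (λ x y z → ≡⇒≈ (ℤP.*-distribʳ-+ x y z))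
      }
    ; *-comm = λ x y → ≡⇒≈ (ℤP.*-comm x y)
    }

module PrimeField (p : ℕ) (prime : Prime p) where
  open CRing (FpR p) (FpR-isCommutativeRng p)

  instance
    p≢0 : ℕ.NonZero p
    p≢0 = prime⇒nonZero prime

  private
    coprime : ∀ {m} → ¬ (p ℕD.∣ m) → Coprime p m
    coprime {m} p∤m {d} (d∣p , d∣m) with prime⇒irreducible prime d∣p
    ... | inj₁ d≡1 = d≡1
    ... | inj₂ d≡p = ⊥-elim (p∤m (≡.subst (ℕD._∣ m) d≡p d∣m))

    pos-inverse : ∀ m → ¬ (p ℕD.∣ m) → Σ ℤ (λ y → (+ m ℤ.* y) ≈ + 1)
    pos-inverse m p∤m with coprime-Bézout (coprime p∤m)
    ... | GCD.Bézout.+- a b eq = ℤ.- (+ b) , ≈-via p {+ m ℤ.* ℤ.- (+ b)} {+ 1} (lemma m a b eq) (ℤS.∣m⇒∣-m (ℤS.∣n⇒∣m*n (+ a) ℤS.∣-refl))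
      where
      lemma : ∀ m a b → 1 ℕ.+ b ℕ.* m ≡ a ℕ.* p → + m ℤ.* ℤ.- (+ b) ℤ.- + 1 ≡ ℤ.- (+ a ℤ.* + p)
      lemma m a b e = ≡.trans (rearrange (+ m) (+ b)) (≡.cong ℤ.-_ (≡.trans (≡.cong (λ z → + 1 ℤ.+ z) (≡.sym (ℤP.pos-* b m))) (≡.trans (≡.cong +_ e) (ℤP.pos-* a p))))
        where
        rearrange : ∀ m b → m ℤ.* ℤ.- b ℤ.- + 1 ≡ ℤ.- (+ 1 ℤ.+ b ℤ.* m)
        rearrange = solve-∀
    ... | GCD.Bézout.-+ a b eq = + b , ≈-via p {+ m ℤ.* + b} {+ 1} (lemma m a b eq) (ℤS.∣n⇒∣m*n (+ a) ℤS.∣-refl)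
      where
      lemma : ∀ m a b → 1 ℕ.+ a ℕ.* p ≡ b ℕ.* m → + m ℤ.* + b ℤ.- + 1 ≡ + a ℤ.* + p
      lemma m a b e = ≡.trans (≡.cong (λ z → z ℤ.- + 1) (≡.trans (ℤP.*-comm (+ m) (+ b)) (≡.trans (≡.sym (ℤP.pos-* b m)) (≡.trans (≡.cong +_ (≡.sym e)) (≡.cong (λ z → + 1 ℤ.+ z) (ℤP.pos-* a p)))))) (cancel (+ a ℤ.* + p))
        where
        cancel : ∀ x → + 1 ℤ.+ x ℤ.- + 1 ≡ x
        cancel = solve-∀

  inverse : ∀ x → ¬ ((+ p) ℤD.∣ x) → Σ ℤ (λ y → (x ℤ.* y) ≈ + 1)
  inverse (+ m)    p∤x = pos-inverse m p∤x
  inverse -[1+ n ] p∤x = ℤ.- y , trans { -[1+ n ] ℤ.* ℤ.- y} {+ suc n ℤ.* y} {+ 1} (reflexive { -[1+ n ] ℤ.* ℤ.- y} {+ suc n ℤ.* y} (neg*neg (+ suc n) y)) (proj₂ (pos-inverse (suc n) p∤x))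
    where
    y = proj₁ (pos-inverse (suc n) p∤x)
    neg*neg : ∀ m y → (ℤ.- m) ℤ.* (ℤ.- y) ≡ m ℤ.* y
    neg*neg = solve-∀

  all-subring : Subring allℤ
  all-subring = record { ∈-resp-≈ = λ _ _ → tt ; +-closed = λ _ _ → tt ; *-closed = λ _ _ → tt ; -‿closed = λ _ → tt ; 0-closed = tt ; 1-closed = tt }

  ∣-resp-≈ : ∀ {x y} → x ≈ y → (+ p) ℤD.∣ x → (+ p) ℤD.∣ y
  ∣-resp-≈ {x} {y} x≈y p∣x = ℤS.∣⇒∣ᵤ {+ p} {y} (≡.subst ((+ p) ℤS.∣_) (lemma x y) (ℤS.∣m∣n⇒∣m-n (ℤS.∣ᵤ⇒∣ {+ p} {x} p∣x) (ℤS.∣ᵤ⇒∣ {+ p} {x ℤ.- y} x≈y)))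
    where
    lemma : ∀ x y → x ℤ.- (x ℤ.- y) ≡ y
    lemma = solve-∀

  ∣-square : ∀ x → (+ p) ℤD.∣ (x ℤ.* x) → (+ p) ℤD.∣ x
  ∣-square x p∣xx with euclidsLemma ℤ.∣ x ∣ ℤ.∣ x ∣ prime (≡.subst (p ℕD.∣_) (ℤP.abs-* x x) p∣xx)
  ... | inj₁ p∣x = p∣x
  ... | inj₂ p∣x = p∣x

  ∣⇒∣-square : ∀ x → (+ p) ℤD.∣ x → (+ p) ℤD.∣ (x ℤ.* x)
  ∣⇒∣-square x p∣x = ≡.subst (p ℕD.∣_) (≡.sym (ℤP.abs-* x x)) (ℕD.∣-trans p∣x (ℕD.m∣m*n ℤ.∣ x ∣))

  fromℤ≈ : ∀ k → fromℤ (+ k) ≈ + k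
  fromℤ≈ zero    = refl {+ 0}
  fromℤ≈ (suc k) = trans {fromℤ (+ suc k)} {+ 1 ℤ.+ fromℤ (+ k)} {+ suc k} (fromℤ-+ (+ 1) (+ k)) (+-congˡ {+ 1} {fromℤ (+ k)} {+ k} (fromℤ≈ k))

  prime-field : ∀ x → Σ ℕ (λ k → fromℤ (+ k) ≈ x)
  prime-field x = x ℤDM.%ℕ p , trans {fromℤ (+ r)} {+ r} {x} (fromℤ≈ r)
    (≈-via p {+ r} {x} (lemma (+ r) (x ℤDM./ℕ p) x (ℤDM.a≡a%ℕn+[a/ℕn]*n x p)) (ℤS.∣m⇒∣-m (ℤS.∣n⇒∣m*n (x ℤDM./ℕ p) ℤS.∣-refl)))
    where
    r = x ℤDM.%ℕ p
    lemma : ∀ k q x → x ≡ k ℤ.+ q ℤ.* + p → k ℤ.- x ≡ ℤ.- (q ℤ.* + p)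
    lemma k q x ≡.refl = rearrange k q (+ p)
      where
      rearrange : ∀ k q r → k ℤ.- (k ℤ.+ q ℤ.* r) ≡ ℤ.- (q ℤ.* r)
      rearrange = solve-∀

  part3 : ∀ P Q → ¬ ((+ p) ℤD.∣ Q) → Part3 P Q p
  part3 P Q p∤Q = (λ _ → IrreducibleCase.theorem (FpR p) (FpR-isCommutativeRng p) allℤ all-subring P Q tt Q-unit) , split , repeated
    where
    Q-unit : Unit (FpR p) allℤ Q
    Q-unit = tt , proj₁ (inverse Q p∤Q) , tt , proj₂ (inverse Q p∤Q)

    split : ∀ θ₁ θ₂ r → Roots (FpR p) allℤ P Q θ₁ θ₂ → (r ℤ.* θ₂) ≡[mod p ] θ₁ → ¬ ((+ p) ℤD.∣ Disc P Q) →
            RedIso (FpR p) allℤ P Q θ₁ θ₂ r (Unit (FpR p) allℤ)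
    split θ₁ θ₂ r roots rθ₂≈θ₁ p∤D = Iso.theorem
      where
      d = θ₁ ℤ.- θ₂
      p∤d : ¬ ((+ p) ℤD.∣ d)
      p∤d p∣d = p∤D (∣-resp-≈ {d ℤ.* d} {Disc P Q} (roots-difference² {allℤ} {P} {Q} {θ₁} {θ₂} roots) (∣⇒∣-square d p∣d))
      open SplitCase (FpR p) (FpR-isCommutativeRng p) allℤ all-subring P Q tt Q-unit θ₁ θ₂ r tt tt roots rθ₂≈θ₁
                     (proj₁ (inverse d p∤d)) (proj₂ (inverse d p∤d))
      module Iso = Isomorphism (Unit (FpR p) allℤ) units-image-∈ (units-realisable tt)

    repeated : (+ p) ℤD.∣ Disc P Q → Reducible (FpR p) allℤ P Q → Trivial (FpR p) allℤ P Q
    repeated p∣D (a , b , (a+b , ab)) = RepeatedRoot.trivial (FpR p) (FpR-isCommutativeRng p) P Q a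
      (trans {a ℤ.+ a} {a ℤ.+ b} {P} (+-congˡ {a} {a} {b} a≈b) a+b) (trans {a ℤ.* a} {a ℤ.* b} {Q} (*-congˡ {a} {a} {b} a≈b) ab)
      (proj₁ (inverse Q p∤Q)) (proj₂ (inverse Q p∤Q)) prime-field
      where
      a≈b : a ≈ b
      a≈b = ∣-square (a ℤ.- b) (∣-resp-≈ {Disc P Q} {(a ℤ.- b) ℤ.* (a ℤ.- b)} (sym {(a ℤ.- b) ℤ.* (a ℤ.- b)} {Disc P Q} (roots-difference² {allℤ} {P} {Q} {a} {b} (a+b , ab))) p∣D)

ℚR-isCommutativeRng : IsCommutativeRng ℚR
ℚR-isCommutativeRng = ℚP.+-*-isCommutativeRing

open CRing ℚR ℚR-isCommutativeRng public using (ι; solve; _:+_; _:*_; :-_; _:-_; _:=_; con)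

private
  ι-unnormalised : ∀ i → toℚᵘ (ι i) ℚᵘ.≃ mkℚᵘ i 0
  ι-unnormalised i = ℚP.toℚᵘ-fromℚᵘ (mkℚᵘ i 0)

  module ≃-Reasoning = SetoidReasoning ℚᵘP.≃-setoid

ι-+ : ∀ i j → ι (i ℤ.+ j) ≡ ι i ℚ.+ ι j
ι-+ i j = ℚP.toℚᵘ-injective (begin
    toℚᵘ (ι (i ℤ.+ j))              ≈⟨ ι-unnormalised (i ℤ.+ j) ⟩
    mkℚᵘ (i ℤ.+ j) 0                ≈⟨ *≡* (lemma i j) ⟩
    mkℚᵘ i 0 ℚᵘ.+ mkℚᵘ j 0          ≈⟨ ℚᵘP.+-cong (ι-unnormalised i) (ι-unnormalised j) ⟨
    toℚᵘ (ι i) ℚᵘ.+ toℚᵘ (ι j)      ≈⟨ ℚP.toℚᵘ-homo-+ (ι i) (ι j) ⟨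
    toℚᵘ (ι i ℚ.+ ι j)              ∎)
  where
  open ≃-Reasoning
  lemma : ∀ i j → (i ℤ.+ j) ℤ.* (+ 1) ≡ (i ℤ.* + 1 ℤ.+ j ℤ.* + 1) ℤ.* + 1
  lemma = solve-∀

ι-* : ∀ i j → ι (i ℤ.* j) ≡ ι i ℚ.* ι j
ι-* i j = ℚP.toℚᵘ-injective (begin
    toℚᵘ (ι (i ℤ.* j))              ≈⟨ ι-unnormalised (i ℤ.* j) ⟩
    mkℚᵘ (i ℤ.* j) 0                ≈⟨ ℚᵘP.≃-refl ⟩
    mkℚᵘ i 0 ℚᵘ.* mkℚᵘ j 0          ≈⟨ ℚᵘP.*-cong (ι-unnormalised i) (ι-unnormalised j) ⟨
    toℚᵘ (ι i) ℚᵘ.* toℚᵘ (ι j)      ≈⟨ ℚP.toℚᵘ-homo-* (ι i) (ι j) ⟨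
    toℚᵘ (ι i ℚ.* ι j)              ∎)
  where open ≃-Reasoning

ι-neg : ∀ i → ι (ℤ.- i) ≡ ℚ.- ι i
ι-neg i = ℚP.toℚᵘ-injective (begin
    toℚᵘ (ι (ℤ.- i))      ≈⟨ ι-unnormalised (ℤ.- i) ⟩
    ℚᵘ.- mkℚᵘ i 0         ≈⟨ ℚᵘP.-‿cong (ι-unnormalised i) ⟨
    ℚᵘ.- toℚᵘ (ι i)       ≈⟨ ℚP.toℚᵘ-homo‿- (ι i) ⟨
    toℚᵘ (ℚ.- ι i)        ∎)
  where open ≃-Reasoning

ι-injective : ∀ {i j} → ι i ≡ ι j → i ≡ j
ι-injective {i} {j} e with ℚᵘP.≃-trans (ℚᵘP.≃-sym (ι-unnormalised i)) (ℚᵘP.≃-trans (ℚP.toℚᵘ-cong e) (ι-unnormalised j))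
... | *≡* eq = ≡.trans (≡.sym (ℤP.*-identityʳ i)) (≡.trans eq (ℤP.*-identityʳ j))

ι-Disc : ∀ P Q → ι P ℚ.* ι P ℚ.- ι (+ 4) ℚ.* ι Q ≡ ι (Disc P Q)
ι-Disc P Q = ≡.sym (≡.trans (ι-+ (P ℤ.* P) (ℤ.- (+ 4 ℤ.* Q)))
                   (≡.cong₂ ℚ._+_ (ι-* P P) (≡.trans (ι-neg (+ 4 ℤ.* Q)) (≡.cong ℚ.-_ (ι-* (+ 4) Q)))))

ι≢0 : ∀ {n} → n ≢ + 0 → ι n ≢ 0ℚ
ι≢0 n≢0 e = n≢0 (ι-injective e)

*-denominator : ∀ x → x ℚ.* ι (↧ x) ≡ ι (↥ x)
*-denominator x@(mkℚ n d _) = ℚP.toℚᵘ-injective (ℚᵘP.≃-trans (ℚP.toℚᵘ-homo-* x (ι (↧ x)))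
  (ℚᵘP.≃-trans (ℚᵘP.*-cong (ℚᵘP.≃-refl {toℚᵘ x}) (ι-unnormalised (↧ x))) (ℚᵘP.≃-trans (*≡* (lemma n d)) (ℚᵘP.≃-sym (ι-unnormalised n)))))
  where
  lemma : ∀ n d → (n ℤ.* + suc d) ℤ.* + 1 ≡ n ℤ.* + suc (d ℕ.* 1)
  lemma n d = ≡.trans (ℤP.*-identityʳ _) (≡.cong (λ z → n ℤ.* + suc z) (≡.sym (ℕP.*-identityʳ d)))

denominator-∣ : ∀ x a b → x ℚ.* ι b ≡ ι a → ↧ₙ x ℕD.∣ ℤ.∣ b ∣
denominator-∣ x@(mkℚ n d c) a b e = recompute (suc d ℕD.∣? ℤ.∣ b ∣) (coprime-divisor (Coprimality.sym c) (ℕD.divides ℤ.∣ a ∣ ∣n∣∣b∣≡∣a∣[1+d]))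
  where
  cross : (↥ x) ℤ.* b ≡ a ℤ.* (↧ x)
  cross with ℚᵘP.≃-trans (ℚᵘP.≃-sym (ℚᵘP.*-cong (ℚᵘP.≃-refl {toℚᵘ x}) (ι-unnormalised b)))
               (ℚᵘP.≃-trans (ℚᵘP.≃-sym (ℚP.toℚᵘ-homo-* x (ι b))) (ℚᵘP.≃-trans (ℚP.toℚᵘ-cong e) (ι-unnormalised a)))
  ... | *≡* eq = ≡.trans (≡.sym (ℤP.*-identityʳ (n ℤ.* b))) (≡.trans eq (≡.cong (λ z → a ℤ.* + suc z) (ℕP.*-identityʳ d)))
  ∣n∣∣b∣≡∣a∣[1+d] : ℤ.∣ n ∣ ℕ.* ℤ.∣ b ∣ ≡ ℤ.∣ a ∣ ℕ.* suc d
  ∣n∣∣b∣≡∣a∣[1+d] = ≡.trans (≡.sym (ℤP.abs-* n b)) (≡.trans (≡.cong ℤ.∣_∣ cross) (ℤP.abs-* a (+ suc d)))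

numerator² : ∀ d D → d ℚ.* d ≡ ι D → ↥ d ℤ.* ↥ d ≡ D ℤ.* (↧ d ℤ.* ↧ d)
numerator² d D dd≡D = ι-injective (begin
  ι (↥ d ℤ.* ↥ d)                         ≡⟨ ι-* (↥ d) (↥ d) ⟩
  ι (↥ d) ℚ.* ι (↥ d)                     ≡⟨ ≡.cong₂ ℚ._*_ (*-denominator d) (*-denominator d) ⟨
  (d ℚ.* ι (↧ d)) ℚ.* (d ℚ.* ι (↧ d))     ≡⟨ solve 2 (λ x b → (x :* b) :* (x :* b) := (x :* x) :* (b :* b)) ≡.refl d (ι (↧ d)) ⟩
  (d ℚ.* d) ℚ.* (ι (↧ d) ℚ.* ι (↧ d))     ≡⟨ ≡.cong₂ ℚ._*_ dd≡D (≡.sym (ι-* (↧ d) (↧ d))) ⟩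
  ι D ℚ.* ι (↧ d ℤ.* ↧ d)                 ≡⟨ ι-* D (↧ d ℤ.* ↧ d) ⟨
  ι (D ℤ.* (↧ d ℤ.* ↧ d))                 ∎)
  where open ≡.≡-Reasoning

inverse : (x : ℚ) → x ≢ 0ℚ → Σ ℚ (λ y → x ℚ.* y ≡ 1ℚ)
inverse x x≢0 = ℚ.1/_ x {{ℚ.≢-nonZero x≢0}} , ℚP.*-inverseʳ x {{ℚ.≢-nonZero x≢0}}

all-subring : CRing.Subring ℚR ℚR-isCommutativeRng all
all-subring = record { ∈-resp-≈ = λ _ _ → tt ; +-closed = λ _ _ → tt ; *-closed = λ _ _ → tt ; -‿closed = λ _ → tt ; 0-closed = tt ; 1-closed = tt }

roots-difference² : ∀ {S P Q θ₁ θ₂} → Roots ℚR S P Q θ₁ θ₂ → (θ₁ ℚ.- θ₂) ℚ.* (θ₁ ℚ.- θ₂) ≡ ι (Disc P Q)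
roots-difference² {S} {P} {Q} {θ₁} {θ₂} roots = ≡.trans (CRing.roots-difference² ℚR ℚR-isCommutativeRng {S} {P} {Q} {θ₁} {θ₂} roots) (ι-Disc P Q)

roots-distinct : ∀ {S P Q θ₁ θ₂} → Disc P Q ≢ + 0 → Roots ℚR S P Q θ₁ θ₂ → θ₁ ℚ.- θ₂ ≢ 0ℚ
roots-distinct {S} {P} {Q} {θ₁} {θ₂} D≢0 roots d≡0 = ι≢0 D≢0 (≡.trans (≡.sym (roots-difference² {S} {P} {Q} {θ₁} {θ₂} roots)) (≡.cong (λ d → d ℚ.* d) d≡0))

part1 : ∀ P Q → Q ≢ + 0 → Disc P Q ≢ + 0 → Part1 P Q
part1 P Q Q≢0 D≢0 = (λ _ → IrreducibleCase.theorem ℚR ℚR-isCommutativeRng all all-subring P Q tt Q-unit) , split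
  where
  Q-unit : Unit ℚR all (ι Q)
  Q-unit = tt , proj₁ (inverse (ι Q) (ι≢0 Q≢0)) , tt , proj₂ (inverse (ι Q) (ι≢0 Q≢0))
  split : ∀ θ₁ θ₂ r → Roots ℚR all P Q θ₁ θ₂ → r ℚ.* θ₂ ≡ θ₁ → RedIso ℚR all P Q θ₁ θ₂ r (Unit ℚR all)
  split θ₁ θ₂ r roots rθ₂≡θ₁ = Iso.theorem
    where
    d⁻¹ = inverse (θ₁ ℚ.- θ₂) (roots-distinct {all} {P} {Q} {θ₁} {θ₂} D≢0 roots)
    open SplitCase ℚR ℚR-isCommutativeRng all all-subring P Q tt Q-unit θ₁ θ₂ r tt tt roots rθ₂≡θ₁ (proj₁ d⁻¹) (proj₂ d⁻¹)
    module Iso = Isomorphism (Unit ℚR all) units-image-∈ (units-realisable tt)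

module Localisation (p : ℕ) (prime : Prime p) where
  open ≡.≡-Reasoning

  instance
    p≢0 : ℕ.NonZero p
    p≢0 = prime⇒nonZero prime

  p≢1 : p ≢ 1
  p≢1 = ℕ.nonTrivial⇒≢1 {{prime⇒nonTrivial prime}}

  p∤1 : ¬ (p ℕD.∣ 1)
  p∤1 p∣1 = p≢1 (ℕD.∣1⇒≡1 p∣1)

  p∤* : ∀ {a b} → ¬ (p ℕD.∣ a) → ¬ (p ℕD.∣ b) → ¬ (p ℕD.∣ (a ℕ.* b))
  p∤* {a} {b} p∤a p∤b p∣ab with euclidsLemma a b prime p∣ab
  ... | inj₁ p∣a = p∤a p∣a
  ... | inj₂ p∣b = p∤b p∣b

  p∤∣*∣ : ∀ {a b} → ¬ (p ℕD.∣ ℤ.∣ a ∣) → ¬ (p ℕD.∣ ℤ.∣ b ∣) → ¬ (p ℕD.∣ ℤ.∣ a ℤ.* b ∣)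
  p∤∣*∣ {a} {b} p∤a p∤b p∣ab = p∤* p∤a p∤b (≡.subst (p ℕD.∣_) (ℤP.abs-* a b) p∣ab)

  p^k≢0 : ∀ k → + (p ℕ.^ k) ≢ + 0
  p^k≢0 k e = ℕ.≢-nonZero⁻¹ (p ℕ.^ k) {{ℕP.m^n≢0 p k}} (ℤP.+-injective e)

  p∣n≡0 : ∀ {n} → n ≡ + 0 → p ℕD.∣ ℤ.∣ n ∣
  p∣n≡0 ≡.refl = ℕD.divides 0 ≡.refl

  ∈-from-integers : ∀ x a b → x ℚ.* ι b ≡ ι a → ¬ (p ℕD.∣ ℤ.∣ b ∣) → InZp p x
  ∈-from-integers x a b e p∤b p∣↧x = p∤b (ℕD.∣-trans p∣↧x (denominator-∣ x a b e))

  +-closed : ∀ {x y} → InZp p x → InZp p y → InZp p (x ℚ.+ y)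
  +-closed {x} {y} sx sy = ∈-from-integers (x ℚ.+ y) (↥ x ℤ.* ↧ y ℤ.+ ↥ y ℤ.* ↧ x) (↧ x ℤ.* ↧ y) eq (p∤∣*∣ {↧ x} {↧ y} sx sy)
    where
    eq : (x ℚ.+ y) ℚ.* ι (↧ x ℤ.* ↧ y) ≡ ι (↥ x ℤ.* ↧ y ℤ.+ ↥ y ℤ.* ↧ x)
    eq = begin
      (x ℚ.+ y) ℚ.* ι (↧ x ℤ.* ↧ y)                                 ≡⟨ ≡.cong ((x ℚ.+ y) ℚ.*_) (ι-* (↧ x) (↧ y)) ⟩
      (x ℚ.+ y) ℚ.* (ι (↧ x) ℚ.* ι (↧ y))                           ≡⟨ solve 4 (λ x y a b → (x :+ y) :* (a :* b) := (x :* a) :* b :+ (y :* b) :* a) ≡.refl x y (ι (↧ x)) (ι (↧ y)) ⟩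
      (x ℚ.* ι (↧ x)) ℚ.* ι (↧ y) ℚ.+ (y ℚ.* ι (↧ y)) ℚ.* ι (↧ x)   ≡⟨ ≡.cong₂ (λ a b → a ℚ.* ι (↧ y) ℚ.+ b ℚ.* ι (↧ x)) (*-denominator x) (*-denominator y) ⟩
      ι (↥ x) ℚ.* ι (↧ y) ℚ.+ ι (↥ y) ℚ.* ι (↧ x)                   ≡⟨ ≡.trans (ι-+ (↥ x ℤ.* ↧ y) (↥ y ℤ.* ↧ x)) (≡.cong₂ ℚ._+_ (ι-* (↥ x) (↧ y)) (ι-* (↥ y) (↧ x))) ⟨
      ι (↥ x ℤ.* ↧ y ℤ.+ ↥ y ℤ.* ↧ x)                               ∎

  *-closed : ∀ {x y} → InZp p x → InZp p y → InZp p (x ℚ.* y)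
  *-closed {x} {y} sx sy = ∈-from-integers (x ℚ.* y) (↥ x ℤ.* ↥ y) (↧ x ℤ.* ↧ y) eq (p∤∣*∣ {↧ x} {↧ y} sx sy)
    where
    eq : (x ℚ.* y) ℚ.* ι (↧ x ℤ.* ↧ y) ≡ ι (↥ x ℤ.* ↥ y)
    eq = begin
      (x ℚ.* y) ℚ.* ι (↧ x ℤ.* ↧ y)             ≡⟨ ≡.cong ((x ℚ.* y) ℚ.*_) (ι-* (↧ x) (↧ y)) ⟩
      (x ℚ.* y) ℚ.* (ι (↧ x) ℚ.* ι (↧ y))       ≡⟨ solve 4 (λ x y a b → (x :* y) :* (a :* b) := (x :* a) :* (y :* b)) ≡.refl x y (ι (↧ x)) (ι (↧ y)) ⟩
      (x ℚ.* ι (↧ x)) ℚ.* (y ℚ.* ι (↧ y))       ≡⟨ ≡.cong₂ ℚ._*_ (*-denominator x) (*-denominator y) ⟩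
      ι (↥ x) ℚ.* ι (↥ y)                       ≡⟨ ι-* (↥ x) (↥ y) ⟨
      ι (↥ x ℤ.* ↥ y)                           ∎

  -‿closed : ∀ {x} → InZp p x → InZp p (ℚ.- x)
  -‿closed {x} sx = ∈-from-integers (ℚ.- x) (ℤ.- ↥ x) (↧ x) eq sx
    where
    eq : (ℚ.- x) ℚ.* ι (↧ x) ≡ ι (ℤ.- ↥ x)
    eq = begin
      (ℚ.- x) ℚ.* ι (↧ x)     ≡⟨ solve 2 (λ x a → (:- x) :* a := :- (x :* a)) ≡.refl x (ι (↧ x)) ⟩
      ℚ.- (x ℚ.* ι (↧ x))     ≡⟨ ≡.cong ℚ.-_ (*-denominator x) ⟩
      ℚ.- ι (↥ x)             ≡⟨ ι-neg (↥ x) ⟨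
      ι (ℤ.- ↥ x)             ∎

  ι-∈ : ∀ n → InZp p (ι n)
  ι-∈ n = ∈-from-integers (ι n) n (+ 1) (ℚP.*-identityʳ (ι n)) p∤1

  subring : CRing.Subring ℚR ℚR-isCommutativeRng (InZp p)
  subring = record
    { ∈-resp-≈ = λ { ≡.refl sx → sx } ; +-closed = λ {x} {y} → +-closed {x} {y} ; *-closed = λ {x} {y} → *-closed {x} {y}
    ; -‿closed = λ {x} → -‿closed {x} ; 0-closed = ι-∈ (+ 0) ; 1-closed = ι-∈ (+ 1) }

  private
    cleared-root : ∀ P Q x a b → x ℚ.* ι b ≡ ι a → x ℚ.* x ≡ ι P ℚ.* x ℚ.- ι Q → a ℤ.* a ≡ b ℤ.* (P ℤ.* a ℤ.- Q ℤ.* b)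
    cleared-root P Q x a b xb≡a e = ι-injective (begin
      ι (a ℤ.* a)                                           ≡⟨ ι-* a a ⟩
      ι a ℚ.* ι a                                           ≡⟨ ≡.cong₂ ℚ._*_ xb≡a xb≡a ⟨
      (x ℚ.* ι b) ℚ.* (x ℚ.* ι b)                           ≡⟨ solve 2 (λ x b → (x :* b) :* (x :* b) := (x :* x) :* (b :* b)) ≡.refl x (ι b) ⟩
      (x ℚ.* x) ℚ.* (ι b ℚ.* ι b)                           ≡⟨ ≡.cong (ℚ._* (ι b ℚ.* ι b)) e ⟩
      (ι P ℚ.* x ℚ.- ι Q) ℚ.* (ι b ℚ.* ι b)                 ≡⟨ solve 4 (λ P x Q b → (P :* x :- Q) :* (b :* b) := b :* (P :* (x :* b) :- Q :* b)) ≡.refl (ι P) x (ι Q) (ι b) ⟩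
      ι b ℚ.* (ι P ℚ.* (x ℚ.* ι b) ℚ.- ι Q ℚ.* ι b)         ≡⟨ ≡.cong (λ z → ι b ℚ.* (ι P ℚ.* z ℚ.- ι Q ℚ.* ι b)) xb≡a ⟩
      ι b ℚ.* (ι P ℚ.* ι a ℚ.- ι Q ℚ.* ι b)                 ≡⟨ ≡.trans (ι-* b (P ℤ.* a ℤ.- Q ℤ.* b)) (≡.cong (ι b ℚ.*_) (≡.trans (ι-+ (P ℤ.* a) (ℤ.- (Q ℤ.* b))) (≡.cong₂ ℚ._+_ (ι-* P a) (≡.trans (ι-neg (Q ℤ.* b)) (≡.cong ℚ.-_ (ι-* Q b)))))) ⟨
      ι (b ℤ.* (P ℤ.* a ℤ.- Q ℤ.* b))                       ∎)

    ∣-square : ∀ (n b y : ℤ) → n ℤ.* n ≡ b ℤ.* y → p ℕD.∣ ℤ.∣ b ∣ → p ℕD.∣ ℤ.∣ n ∣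
    ∣-square n b y nn≡by p∣b with euclidsLemma ℤ.∣ n ∣ ℤ.∣ n ∣ prime p∣nn
      where
      p∣nn : p ℕD.∣ ℤ.∣ n ∣ ℕ.* ℤ.∣ n ∣
      p∣nn = ≡.subst (p ℕD.∣_) (≡.trans (≡.sym (ℤP.abs-* b y)) (≡.trans (≡.cong ℤ.∣_∣ (≡.sym nn≡by)) (ℤP.abs-* n n)))
                     (ℕD.∣-trans p∣b (ℕD.m∣m*n ℤ.∣ y ∣))
    ... | inj₁ p∣n = p∣n
    ... | inj₂ p∣n = p∣n

  root-∈ : ∀ P Q x → x ℚ.* x ≡ ι P ℚ.* x ℚ.- ι Q → InZp p x
  root-∈ P Q x@(mkℚ n _ coprime) e p∣↧x = p≢1 (recompute (p ℕ.≟ 1) (coprime (p∣n , p∣↧x)))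
    where
    p∣n = ∣-square (↥ x) (↧ x) (P ℤ.* ↥ x ℤ.- Q ℤ.* ↧ x) (cleared-root P Q x (↥ x) (↧ x) (*-denominator x) e) p∣↧x

  factor-p : ∀ n → n ≢ 0 → Σ ℕ (λ k → Σ ℕ (λ m → (n ≡ p ℕ.^ k ℕ.* m) × ¬ (p ℕD.∣ m)))
  factor-p = <-rec _ factor
    where
    factor : ∀ n → (∀ {q} → q ℕ.< n → q ≢ 0 → Σ ℕ (λ k → Σ ℕ (λ m → (q ≡ p ℕ.^ k ℕ.* m) × ¬ (p ℕD.∣ m)))) →
             n ≢ 0 → Σ ℕ (λ k → Σ ℕ (λ m → (n ≡ p ℕ.^ k ℕ.* m) × ¬ (p ℕD.∣ m)))
    factor n rec n≢0 with p ℕD.∣? n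
    ... | no p∤n = 0 , n , ≡.sym (ℕP.+-identityʳ n) , p∤n
    ... | yes (ℕD.divides q n≡qp) =
      let (k , m , q≡ , p∤m) = rec q<n q≢0 in
      suc k , m , ≡.trans n≡qp (≡.trans (≡.cong (ℕ._* p) q≡) (reorder (p ℕ.^ k) m)) , p∤m
      where
      q≢0 : q ≢ 0
      q≢0 ≡.refl = n≢0 n≡qp
      q<n : q ℕ.< n
      q<n = ≡.subst (q ℕ.<_) (≡.sym n≡qp) (ℕP.m<m*n q p {{ℕ.≢-nonZero q≢0}} (ℕ.nonTrivial⇒n>1 p {{prime⇒nonTrivial prime}}))
      reorder : ∀ a m → a ℕ.* m ℕ.* p ≡ p ℕ.* a ℕ.* m
      reorder a m = ≡.trans (ℕP.*-comm (a ℕ.* m) p) (≡.sym (ℕP.*-assoc p a m))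

  valuation-unique : ∀ i j x y → p ℕ.^ i ℕ.* x ≡ p ℕ.^ j ℕ.* y → ¬ (p ℕD.∣ x) → ¬ (p ℕD.∣ y) → i ≡ j
  valuation-unique zero    zero    x y e p∤x p∤y = ≡.refl
  valuation-unique zero    (suc j) x y e p∤x p∤y = ⊥-elim (p∤x (ℕD.divides (p ℕ.^ j ℕ.* y) (≡.trans (≡.trans (≡.sym (ℕP.+-identityʳ x)) e) (≡.trans (ℕP.*-assoc p _ y) (ℕP.*-comm p _)))))
  valuation-unique (suc i) zero    x y e p∤x p∤y = ⊥-elim (p∤y (ℕD.divides (p ℕ.^ i ℕ.* x) (≡.trans (≡.trans (≡.sym (ℕP.+-identityʳ y)) (≡.sym e)) (≡.trans (ℕP.*-assoc p _ x) (ℕP.*-comm p _)))))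
  valuation-unique (suc i) (suc j) x y e p∤x p∤y =
    ≡.cong suc (valuation-unique i j x y (ℕP.*-cancelˡ-≡ _ _ p (≡.trans (≡.sym (ℕP.*-assoc p _ x)) (≡.trans e (ℕP.*-assoc p _ y)))) p∤x p∤y)

  private
    signed-factor : ∀ (a : ℤ) m n → ℤ.∣ a ∣ ≡ m ℕ.* n → Σ ℤ (λ a′ → (a ≡ + m ℤ.* a′) × (ℤ.∣ a′ ∣ ≡ n))
    signed-factor (+ _)    m n e = + n , ≡.trans (≡.cong +_ e) (ℤP.pos-* m n) , ≡.refl
    signed-factor -[1+ _ ] m n e = ℤ.- (+ n) ,
      ≡.trans (≡.cong (λ z → ℤ.- (+ z)) e) (≡.trans (≡.cong ℤ.-_ (ℤP.pos-* m n)) (ℤP.neg-distribʳ-* (+ m) (+ n))) , ℤP.∣-i∣≡∣i∣ (+ n)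

    ∣p^s∣ : ∀ s → ℤ.∣ (+ p) ℤ.^ s ∣ ≡ p ℕ.^ s
    ∣p^s∣ zero    = ≡.refl
    ∣p^s∣ (suc s) = ≡.trans (ℤP.abs-* (+ p) ((+ p) ℤ.^ s)) (≡.cong (p ℕ.*_) (∣p^s∣ s))

  square-root-valuation : ∀ (n b D D₀ : ℤ) s → n ℤ.* n ≡ D ℤ.* (b ℤ.* b) → ¬ (p ℕD.∣ ℤ.∣ b ∣) →
    D ≢ + 0 → D ≡ (+ p) ℤ.^ s ℤ.* D₀ → ¬ (p ℕD.∣ ℤ.∣ D₀ ∣) →
    Σ ℕ (λ k → (k ℕ.+ k ≡ s) × Σ ℤ (λ n′ → (n ≡ + (p ℕ.^ k) ℤ.* n′) × ¬ (p ℕD.∣ ℤ.∣ n′ ∣)))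
  square-root-valuation n b D D₀ s nn≡Dbb p∤b D≢0 D≡ p∤D₀ =
    k , k+k≡s , proj₁ sf , proj₁ (proj₂ sf) , (λ p∣n′ → p∤m (≡.subst (p ℕD.∣_) (proj₂ (proj₂ sf)) p∣n′))
    where
    B = ℤ.∣ b ∣
    ∣n∣² : ℤ.∣ n ∣ ℕ.* ℤ.∣ n ∣ ≡ ℤ.∣ D ∣ ℕ.* (B ℕ.* B)
    ∣n∣² = ≡.trans (≡.sym (ℤP.abs-* n n)) (≡.trans (≡.cong ℤ.∣_∣ nn≡Dbb) (≡.trans (ℤP.abs-* D (b ℤ.* b)) (≡.cong (ℤ.∣ D ∣ ℕ.*_) (ℤP.abs-* b b))))
    ∣n∣≢0 : ℤ.∣ n ∣ ≢ 0
    ∣n∣≢0 e0 = D≢0 (ℤP.∣i∣≡0⇒i≡0 (ℕP.m*n≡0⇒m≡0 ℤ.∣ D ∣ (B ℕ.* B) {{ℕ.≢-nonZero B*B≢0}} (≡.trans (≡.sym ∣n∣²) (≡.cong (λ z → z ℕ.* z) e0))))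
      where
      B*B≢0 : B ℕ.* B ≢ 0
      B*B≢0 e = p∤* p∤b p∤b (≡.subst (p ℕD.∣_) (≡.sym e) (ℕD.divides 0 ≡.refl))
    factored = factor-p ℤ.∣ n ∣ ∣n∣≢0
    k = proj₁ factored
    m = proj₁ (proj₂ factored)
    ∣n∣≡ = proj₁ (proj₂ (proj₂ factored))
    p∤m = proj₂ (proj₂ (proj₂ factored))
    sf = signed-factor n (p ℕ.^ k) m ∣n∣≡
    k+k≡s : k ℕ.+ k ≡ s
    k+k≡s = valuation-unique (k ℕ.+ k) s (m ℕ.* m) (ℤ.∣ D₀ ∣ ℕ.* (B ℕ.* B)) (begin
      p ℕ.^ (k ℕ.+ k) ℕ.* (m ℕ.* m)                 ≡⟨ ≡.cong (ℕ._* (m ℕ.* m)) (ℕP.^-distribˡ-+-* p k k) ⟩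
      (p ℕ.^ k ℕ.* p ℕ.^ k) ℕ.* (m ℕ.* m)           ≡⟨ square-* (p ℕ.^ k) m ⟩
      (p ℕ.^ k ℕ.* m) ℕ.* (p ℕ.^ k ℕ.* m)           ≡⟨ ≡.cong₂ ℕ._*_ ∣n∣≡ ∣n∣≡ ⟨
      ℤ.∣ n ∣ ℕ.* ℤ.∣ n ∣                           ≡⟨ ∣n∣² ⟩
      ℤ.∣ D ∣ ℕ.* (B ℕ.* B)                         ≡⟨ ≡.cong (λ z → ℤ.∣ z ∣ ℕ.* (B ℕ.* B)) D≡ ⟩
      ℤ.∣ (+ p) ℤ.^ s ℤ.* D₀ ∣ ℕ.* (B ℕ.* B)        ≡⟨ ≡.cong (ℕ._* (B ℕ.* B)) (≡.trans (ℤP.abs-* ((+ p) ℤ.^ s) D₀) (≡.cong (ℕ._* ℤ.∣ D₀ ∣) (∣p^s∣ s))) ⟩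
      p ℕ.^ s ℕ.* ℤ.∣ D₀ ∣ ℕ.* (B ℕ.* B)            ≡⟨ ℕP.*-assoc (p ℕ.^ s) _ _ ⟩
      p ℕ.^ s ℕ.* (ℤ.∣ D₀ ∣ ℕ.* (B ℕ.* B))          ∎) (p∤* p∤m p∤m) (p∤* p∤D₀ (p∤* p∤b p∤b))
      where
      square-* : ∀ a m → (a ℕ.* a) ℕ.* (m ℕ.* m) ≡ (a ℕ.* m) ℕ.* (a ℕ.* m)
      square-* = ℕSolver.solve-∀

  ratio-unit : ∀ x n b → x ℚ.* ι b ≡ ι n → ¬ (p ℕD.∣ ℤ.∣ n ∣) → ¬ (p ℕD.∣ ℤ.∣ b ∣) → Unit ℚR (InZp p) x
  ratio-unit x n b xb≡n p∤n p∤b = ∈-from-integers x n b xb≡n p∤b , x⁻¹ , x⁻¹∈S , xx⁻¹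
    where
    n≢0 : n ≢ + 0
    n≢0 n≡0 = p∤n (p∣n≡0 n≡0)
    n⁻¹ = proj₁ (inverse (ι n) (ι≢0 n≢0))
    nn⁻¹ = proj₂ (inverse (ι n) (ι≢0 n≢0))
    x⁻¹ = ι b ℚ.* n⁻¹
    x⁻¹∈S : InZp p x⁻¹
    x⁻¹∈S = ∈-from-integers x⁻¹ b n (begin
      (ι b ℚ.* n⁻¹) ℚ.* ι n        ≡⟨ solve 3 (λ b i n → (b :* i) :* n := b :* (n :* i)) ≡.refl (ι b) n⁻¹ (ι n) ⟩
      ι b ℚ.* (ι n ℚ.* n⁻¹)        ≡⟨ ≡.cong (ι b ℚ.*_) nn⁻¹ ⟩
      ι b ℚ.* 1ℚ                   ≡⟨ ℚP.*-identityʳ (ι b) ⟩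
      ι b                          ∎) p∤n
    xx⁻¹ : x ℚ.* x⁻¹ ≡ 1ℚ
    xx⁻¹ = begin
      x ℚ.* (ι b ℚ.* n⁻¹)          ≡⟨ ℚP.*-assoc x (ι b) n⁻¹ ⟨
      (x ℚ.* ι b) ℚ.* n⁻¹          ≡⟨ ≡.cong (ℚ._* n⁻¹) xb≡n ⟩
      ι n ℚ.* n⁻¹                  ≡⟨ nn⁻¹ ⟩
      1ℚ                           ∎

  ι-unit : ∀ n → ¬ (p ℕD.∣ ℤ.∣ n ∣) → Unit ℚR (InZp p) (ι n)
  ι-unit n p∤n = ratio-unit (ι n) n (+ 1) (ℚP.*-identityʳ (ι n)) p∤n p∤1

  -- With d = ↥d/↧d and ↥d = p^k n′, the unit is u = n′/↧d.
  unit-times-p^ : ∀ d (D D₀ : ℤ) s → D ≢ + 0 → D ≡ (+ p) ℤ.^ s ℤ.* D₀ → ¬ (p ℕD.∣ ℤ.∣ D₀ ∣) → InZp p d → d ℚ.* d ≡ ι D →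
    Σ ℕ (λ k → (k ℕ.+ k ≡ s) × Σ ℚ (λ u → Unit ℚR (InZp p) u × (d ≡ u ℚ.* ι (+ (p ℕ.^ k)))))
  unit-times-p^ d D D₀ s D≢0 D≡ p∤D₀ sd dd≡D = k , k+k≡s , u , ratio-unit u n′ (↧ d) ub≡n′ p∤n′ sd , d≡uπ
    where
    valuation = square-root-valuation (↥ d) (↧ d) D D₀ s (numerator² d D dd≡D) sd D≢0 D≡ p∤D₀
    k = proj₁ valuation
    k+k≡s = proj₁ (proj₂ valuation)
    n′ = proj₁ (proj₂ (proj₂ valuation))
    ↥d≡p^kn′ = proj₁ (proj₂ (proj₂ (proj₂ valuation)))
    p∤n′ = proj₂ (proj₂ (proj₂ (proj₂ valuation)))
    π = ι (+ (p ℕ.^ k))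
    π⁻¹ = proj₁ (inverse π (ι≢0 (p^k≢0 k)))
    ππ⁻¹ = proj₂ (inverse π (ι≢0 (p^k≢0 k)))
    u = d ℚ.* π⁻¹
    ub≡n′ : u ℚ.* ι (↧ d) ≡ ι n′
    ub≡n′ = begin
      (d ℚ.* π⁻¹) ℚ.* ι (↧ d)      ≡⟨ solve 3 (λ d i b → (d :* i) :* b := i :* (d :* b)) ≡.refl d π⁻¹ (ι (↧ d)) ⟩
      π⁻¹ ℚ.* (d ℚ.* ι (↧ d))      ≡⟨ ≡.cong (π⁻¹ ℚ.*_) (≡.trans (*-denominator d) (≡.trans (≡.cong ι ↥d≡p^kn′) (ι-* (+ (p ℕ.^ k)) n′))) ⟩
      π⁻¹ ℚ.* (π ℚ.* ι n′)         ≡⟨ ℚP.*-assoc π⁻¹ π (ι n′) ⟨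
      (π⁻¹ ℚ.* π) ℚ.* ι n′         ≡⟨ ≡.cong (ℚ._* ι n′) (≡.trans (ℚP.*-comm π⁻¹ π) ππ⁻¹) ⟩
      1ℚ ℚ.* ι n′                  ≡⟨ ℚP.*-identityˡ (ι n′) ⟩
      ι n′                         ∎
    d≡uπ : d ≡ u ℚ.* π
    d≡uπ = begin
      d                      ≡⟨ ℚP.*-identityʳ d ⟨
      d ℚ.* 1ℚ               ≡⟨ ≡.cong (d ℚ.*_) (≡.trans (ℚP.*-comm π⁻¹ π) ππ⁻¹) ⟨
      d ℚ.* (π⁻¹ ℚ.* π)      ≡⟨ ℚP.*-assoc d π⁻¹ π ⟨
      u ℚ.* π                ∎

  1+multiple-unit : ∀ m z → p ℕD.∣ m → InZp p z → Unit ℚR (InZp p) (1ℚ ℚ.+ ι (+ m) ℚ.* z)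
  1+multiple-unit m z p∣m z∈S = ratio-unit (1ℚ ℚ.+ ι (+ m) ℚ.* z) N (↧ z) tb≡N p∤N z∈S
    where
    N = ↧ z ℤ.+ + m ℤ.* ↥ z
    tb≡N : (1ℚ ℚ.+ ι (+ m) ℚ.* z) ℚ.* ι (↧ z) ≡ ι N
    tb≡N = begin
      (1ℚ ℚ.+ ι (+ m) ℚ.* z) ℚ.* ι (↧ z)                 ≡⟨ solve 4 (λ o m z b → (o :+ m :* z) :* b := o :* b :+ m :* (z :* b)) ≡.refl 1ℚ (ι (+ m)) z (ι (↧ z)) ⟩
      1ℚ ℚ.* ι (↧ z) ℚ.+ ι (+ m) ℚ.* (z ℚ.* ι (↧ z))     ≡⟨ ≡.cong₂ (λ x y → x ℚ.+ ι (+ m) ℚ.* y) (ℚP.*-identityˡ (ι (↧ z))) (*-denominator z) ⟩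
      ι (↧ z) ℚ.+ ι (+ m) ℚ.* ι (↥ z)                    ≡⟨ ≡.trans (ι-+ (↧ z) (+ m ℤ.* ↥ z)) (≡.cong (ι (↧ z) ℚ.+_) (ι-* (+ m) (↥ z))) ⟨
      ι N                                                ∎
    p∤N : ¬ (p ℕD.∣ ℤ.∣ N ∣)
    p∤N p∣N = z∈S (ℤS.∣⇒∣ᵤ {+ p} {↧ z} (≡.subst ((+ p) ℤS.∣_) (cancel (↧ z) (+ m ℤ.* ↥ z))
                  (ℤS.∣m∣n⇒∣m-n (ℤS.∣ᵤ⇒∣ {+ p} {N} p∣N) (ℤS.∣m⇒∣m*n (↥ z) (ℤS.∣ᵤ⇒∣ {+ p} {+ m} p∣m)))))
      where
      cancel : ∀ b c → b ℤ.+ c ℤ.- c ≡ b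
      cancel = solve-∀

root² : ∀ {S P Q θ₁ θ₂} → Roots ℚR S P Q θ₁ θ₂ → (θ₁ ℚ.* θ₁ ≡ ι P ℚ.* θ₁ ℚ.- ι Q) × (θ₂ ℚ.* θ₂ ≡ ι P ℚ.* θ₂ ℚ.- ι Q)
root² {θ₁ = θ₁} {θ₂} (θ₁+θ₂ , θ₁θ₂) =
  ≡.trans (solve 2 (λ a b → a :* a := (a :+ b) :* a :- a :* b) ≡.refl θ₁ θ₂) (≡.cong₂ (λ x y → x ℚ.* θ₁ ℚ.- y) θ₁+θ₂ θ₁θ₂) ,
  ≡.trans (solve 2 (λ a b → b :* b := (a :+ b) :* b :- a :* b) ≡.refl θ₁ θ₂) (≡.cong₂ (λ x y → x ℚ.* θ₂ ℚ.- y) θ₁+θ₂ θ₁θ₂)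

half : ∀ k s → k ℕ.+ k ≡ s → s ℕ./ 2 ≡ k
half k s k+k≡s = ≡.trans (≡.cong (ℕ._/ 2) (≡.trans (≡.sym k+k≡s) (double k))) (ℕDM.m*n/n≡m k 2)
  where
  double : ∀ k → k ℕ.+ k ≡ k ℕ.* 2
  double = ℕSolver.solve-∀

module _ (P Q : ℤ) (D≢0 : Disc P Q ≢ + 0) (p : ℕ) (prime : Prime p) (p∤Q : ¬ ((+ p) ℤD.∣ Q)) (s : ℕ) (D₀ : ℤ)
         (D≡ : Disc P Q ≡ (+ p) ℤ.^ s ℤ.* D₀) (p∤D₀ : ¬ ((+ p) ℤD.∣ D₀)) where
  open Localisation p prime
  open ≡.≡-Reasoning

  private
    S = InZp p
    D = Disc P Q
    Q-unit = ι-unit Q p∤Q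

  p∣p^half : (+ p) ℤD.∣ D → ∀ k → k ℕ.+ k ≡ s → p ℕD.∣ p ℕ.^ k
  p∣p^half p∣D zero    0≡s = ⊥-elim (p∤D₀ (≡.subst (λ x → p ℕD.∣ ℤ.∣ x ∣) D≡D₀ p∣D))
    where
    D≡D₀ : D ≡ D₀
    D≡D₀ = ≡.trans D≡ (≡.trans (≡.cong (λ m → (+ p) ℤ.^ m ℤ.* D₀) (≡.sym 0≡s)) (ℤP.*-identityˡ D₀))
  p∣p^half p∣D (suc j) _ = ℕD.m∣m*n (p ℕ.^ j)

  module _ (θ₁ θ₂ r : ℚ) (roots : Roots ℚR all P Q θ₁ θ₂) (rθ₂≡θ₁ : r ℚ.* θ₂ ≡ θ₁) where
    private
      θ₁∈S = root-∈ P Q θ₁ (proj₁ (root² {all} {P} {Q} {θ₁} {θ₂} roots))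
      θ₂∈S = root-∈ P Q θ₂ (proj₂ (root² {all} {P} {Q} {θ₁} {θ₂} roots))
      d = θ₁ ℚ.- θ₂
      d∈S : S d
      d∈S = +-closed {θ₁} {ℚ.- θ₂} θ₁∈S (-‿closed {θ₂} θ₂∈S)
      dd≡D : d ℚ.* d ≡ ι D
      dd≡D = roots-difference² {all} {P} {Q} {θ₁} {θ₂} roots
      module SplitAt = SplitCase ℚR ℚR-isCommutativeRng S subring P Q (ι-∈ P) Q-unit θ₁ θ₂ r θ₁∈S θ₂∈S roots rθ₂≡θ₁

    -- Since d² = D is a unit, so is d.
    unramified : ¬ ((+ p) ℤD.∣ D) → RedIso ℚR S P Q θ₁ θ₂ r (Unit ℚR S)
    unramified p∤D = Iso.theorem
      where
      D-unit = ι-unit D p∤D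
      D⁻¹ = proj₁ (proj₂ D-unit)
      d⁻¹ = d ℚ.* D⁻¹
      dd⁻¹ : d ℚ.* d⁻¹ ≡ 1ℚ
      dd⁻¹ = ≡.trans (≡.sym (ℚP.*-assoc d d D⁻¹)) (≡.trans (≡.cong (ℚ._* D⁻¹) dd≡D) (proj₂ (proj₂ (proj₂ D-unit))))
      open SplitAt d⁻¹ dd⁻¹
      module Iso = Isomorphism (Unit ℚR S) units-image-∈ (units-realisable (*-closed {d} {D⁻¹} d∈S (proj₁ (proj₂ (proj₂ D-unit)))))

    OnePlus : ℚ → Set
    OnePlus x = Σ ℚ (λ z → InZp p z × (x ≡ ℚ.1ℚ ℚ.+ ((+ (p ℕ.^ (s ℕ./ 2))) ℚ./ 1) ℚ.* z))

    -- Now d = u p^k with u a unit and 2k = s > 0; the image (w₁ - w₀θ₁)/(w₁ - w₀θ₂) = 1 - w₀ d/(w₁ - w₀θ₂) lies in 1 + p^k ℤ_(p).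
    ramified : (+ p) ℤD.∣ D → RedIso ℚR S P Q θ₁ θ₂ r OnePlus
    ramified p∣D = Iso.theorem
      where
      decomposition = unit-times-p^ d D D₀ s D≢0 D≡ p∤D₀ d∈S dd≡D
      k = proj₁ decomposition
      k+k≡s = proj₁ (proj₂ decomposition)
      u = proj₁ (proj₂ (proj₂ decomposition))
      u-unit = proj₁ (proj₂ (proj₂ (proj₂ decomposition)))
      u⁻¹ = proj₁ (proj₂ u-unit)
      d≡uπ = proj₂ (proj₂ (proj₂ (proj₂ decomposition)))
      π = ι (+ (p ℕ.^ k))
      π≡ : ι (+ (p ℕ.^ (s ℕ./ 2))) ≡ π
      π≡ = ≡.cong (λ m → ι (+ (p ℕ.^ m))) (half k s k+k≡s)
      π⁻¹ = proj₁ (inverse π (ι≢0 (p^k≢0 k)))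
      ππ⁻¹ = proj₂ (inverse π (ι≢0 (p^k≢0 k)))
      d⁻¹ = u⁻¹ ℚ.* π⁻¹
      dd⁻¹ : d ℚ.* d⁻¹ ≡ 1ℚ
      dd⁻¹ = begin
        d ℚ.* (u⁻¹ ℚ.* π⁻¹)             ≡⟨ ≡.cong (ℚ._* (u⁻¹ ℚ.* π⁻¹)) d≡uπ ⟩
        (u ℚ.* π) ℚ.* (u⁻¹ ℚ.* π⁻¹)     ≡⟨ solve 4 (λ a b c e → (a :* b) :* (c :* e) := (a :* c) :* (b :* e)) ≡.refl u π u⁻¹ π⁻¹ ⟩
        (u ℚ.* u⁻¹) ℚ.* (π ℚ.* π⁻¹)     ≡⟨ ≡.cong₂ ℚ._*_ (proj₂ (proj₂ (proj₂ u-unit))) ππ⁻¹ ⟩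
        1ℚ                              ∎
      open SplitAt d⁻¹ dd⁻¹

      image-∈ : ∀ w₀ w₁ a⁻¹ b⁻¹ → S w₀ → S w₁ → S a⁻¹ → S b⁻¹ → (w₁ ℚ.- w₀ ℚ.* θ₁) ℚ.* a⁻¹ ≡ 1ℚ → (w₁ ℚ.- w₀ ℚ.* θ₂) ℚ.* b⁻¹ ≡ 1ℚ →
                OnePlus ((w₁ ℚ.- w₀ ℚ.* θ₁) ℚ.* b⁻¹)
      image-∈ w₀ w₁ a⁻¹ b⁻¹ sw₀ _ _ sb⁻¹ _ bb⁻¹ = z , z∈S , (begin
          (w₁ ℚ.- w₀ ℚ.* θ₁) ℚ.* b⁻¹                         ≡⟨ solve 5 (λ w1 w0 t1 t2 bi → (w1 :- w0 :* t1) :* bi := (w1 :- w0 :* t2) :* bi :- w0 :* (t1 :- t2) :* bi) ≡.refl w₁ w₀ θ₁ θ₂ b⁻¹ ⟩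
          (w₁ ℚ.- w₀ ℚ.* θ₂) ℚ.* b⁻¹ ℚ.- w₀ ℚ.* d ℚ.* b⁻¹    ≡⟨ ≡.cong₂ (λ x y → x ℚ.- w₀ ℚ.* y ℚ.* b⁻¹) bb⁻¹ d≡uπ ⟩
          1ℚ ℚ.- w₀ ℚ.* (u ℚ.* π) ℚ.* b⁻¹                   ≡⟨ solve 5 (λ o w0 u π bi → o :- w0 :* (u :* π) :* bi := o :+ π :* (:- (w0 :* u :* bi))) ≡.refl 1ℚ w₀ u π b⁻¹ ⟩
          1ℚ ℚ.+ π ℚ.* z                                    ≡⟨ ≡.cong (λ y → 1ℚ ℚ.+ y ℚ.* z) π≡ ⟨
          1ℚ ℚ.+ ι (+ (p ℕ.^ (s ℕ./ 2))) ℚ.* z               ∎)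
        where
        z = ℚ.- (w₀ ℚ.* u ℚ.* b⁻¹)
        z∈S : S z
        z∈S = -‿closed {w₀ ℚ.* u ℚ.* b⁻¹} (*-closed {w₀ ℚ.* u} {b⁻¹} (*-closed {w₀} {u} sw₀ (proj₁ u-unit)) sb⁻¹)

      realisable : ∀ t → OnePlus t → Unit ℚR S t × S ((1ℚ ℚ.- t) ℚ.* d⁻¹)
      realisable t (z , z∈S , t≡) = ≡.subst (Unit ℚR S) (≡.sym t≡′) (1+multiple-unit (p ℕ.^ k) z (p∣p^half p∣D k k+k≡s) z∈S) ,
        ≡.subst S (≡.sym (begin
          (1ℚ ℚ.- t) ℚ.* (u⁻¹ ℚ.* π⁻¹)                  ≡⟨ ≡.cong (λ x → (1ℚ ℚ.- x) ℚ.* (u⁻¹ ℚ.* π⁻¹)) t≡′ ⟩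
          (1ℚ ℚ.- (1ℚ ℚ.+ π ℚ.* z)) ℚ.* (u⁻¹ ℚ.* π⁻¹)   ≡⟨ solve 5 (λ o π z ui πi → (o :- (o :+ π :* z)) :* (ui :* πi) := (:- (z :* ui)) :* (π :* πi)) ≡.refl 1ℚ π z u⁻¹ π⁻¹ ⟩
          (ℚ.- (z ℚ.* u⁻¹)) ℚ.* (π ℚ.* π⁻¹)             ≡⟨ ≡.cong ((ℚ.- (z ℚ.* u⁻¹)) ℚ.*_) ππ⁻¹ ⟩
          (ℚ.- (z ℚ.* u⁻¹)) ℚ.* 1ℚ                      ≡⟨ ℚP.*-identityʳ (ℚ.- (z ℚ.* u⁻¹)) ⟩
          ℚ.- (z ℚ.* u⁻¹)                               ∎)) (-‿closed {z ℚ.* u⁻¹} (*-closed {z} {u⁻¹} z∈S (proj₁ (proj₂ (proj₂ u-unit)))))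
        where
        t≡′ : t ≡ 1ℚ ℚ.+ π ℚ.* z
        t≡′ = ≡.trans t≡ (≡.cong (λ y → 1ℚ ℚ.+ y ℚ.* z) π≡)

      module Iso = Isomorphism OnePlus image-∈ realisable

  part2 : Part2 P Q p s
  part2 = (λ _ → IrreducibleCase.theorem ℚR ℚR-isCommutativeRng S subring P Q (ι-∈ P) Q-unit) ,
          λ θ₁ θ₂ r roots rθ₂≡θ₁ → unramified θ₁ θ₂ r roots rθ₂≡θ₁ , ramified θ₁ θ₂ r roots rθ₂≡θ₁

open import Data.Integer using (_*_; _^_)
open ℤD using (_∣_)

theorem6 : (P Q : ℤ) → Q ≢ + 0 → Disc P Q ≢ + 0 →
    Part1 P Q
    × ((p : ℕ) → Prime p → ¬ (+ p ∣ Q) → (s : ℕ) (D₀ : ℤ) →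
         Disc P Q ≡ (+ p) ^ s * D₀ → ¬ (+ p ∣ D₀) →
         Part2 P Q p s × Part3 P Q p)
theorem6 P Q Q≢0 D≢0 =
  part1 P Q Q≢0 D≢0 ,
  λ p prime p∤Q s D₀ D≡ p∤D₀ → part2 P Q D≢0 p prime p∤Q s D₀ D≡ p∤D₀ , PrimeField.part3 p prime P Q p∤Q
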